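{- Let $(u_n)_{n \geq 1}$ be a sequence of positive integers with $u_n \to +\infty$ as $n \to +\infty$, and let $k$ be a positive integer. Then for every nonzero integer $t$, the series below converges and $$\sum_{n = 1}^{+\infty} (-1)^{u_n} \frac{F_{u_{n+k} - u_n}}{F_{u_n} F_{u_{n+k}}} = \frac{1}{F_t}\left(\sum_{n=1}^{k} \frac{F_{u_n + t}}{F_{u_n}} - k\,\Phi^t\right).$$
   Context: $(F_n)_{n \in \mathbb{Z}}$ is the Fibonacci sequence: $F_0 = 0$, $F_1 = 1$, $F_{n+2} = F_{n+1} + F_n$ for all $n \in \mathbb{Z}$ (so that $F_{ -n} = (-1)^{n+1} F_n$). $\Phi = \frac{1+\sqrt{5}}{2}$ is the golden ratio. -}

module Defs where

open import Data.Nat as ℕ using (ℕ; zero; suc)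
open import Data.Integer as ℤ using (ℤ; +_; -[1+_])
open import Data.Rational as ℚ using (ℚ; 0ℚ; 1ℚ; ½; ↥_; ↧_)
open import Data.Product using (_×_)
open import Data.Sum using (_⊎_)

negOnePow : ℕ → ℤ
negOnePow zero = + 1
negOnePow (suc n) = ℤ.- negOnePow n

-- Fibonacci numbers on ℤ : F_0 = 0, F_1 = 1, F_{n+2} = F_{n+1} + F_n,
-- extended to negative indices by F_{-m} = (-1)^{m+1} F_m.

fibℕ : ℕ → ℕ
fibℕ zero = zero
fibℕ (suc zero) = suc zero
fibℕ (suc (suc n)) = fibℕ (suc n) ℕ.+ fibℕ n

F : ℤ → ℤ
F (+ n) = + fibℕ n
F -[1+ n ] = negOnePow (suc (suc n)) ℤ.* + fibℕ (suc n)

-- Total division of integers into ℚ (a / 0 := 0; never used with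
-- a zero divisor in the theorem).

divℤ : ℤ → ℤ → ℚ
divℤ a (+ zero) = 0ℚ
divℤ a (+ suc m) = a ℚ./ suc m
divℤ a -[1+ m ] = (ℤ.- a) ℚ./ suc m

-- total reciprocal of a rational (1/0 := 0)
recipℚ : ℚ → ℚ
recipℚ q = divℤ (↧ q) (↥ q)

-- The real quadratic field ℚ(√5) ⊂ ℝ : elements a + b √5.

record Q5 : Set where
  constructor _+√5·_
  field
    re : ℚ
    im : ℚ
open Q5 public

infixl 6 _⊕_ _⊖_
infixl 7 _⊗_

fromℚ : ℚ → Q5
fromℚ q = q +√5· 0ℚ

_⊕_ : Q5 → Q5 → Q5
(a +√5· b) ⊕ (c +√5· d) = (a ℚ.+ c) +√5· (b ℚ.+ d)

⊝_ : Q5 → Q5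
⊝ (a +√5· b) = (ℚ.- a) +√5· (ℚ.- b)

_⊖_ : Q5 → Q5 → Q5
x ⊖ y = x ⊕ (⊝ y)

_⊗_ : Q5 → Q5 → Q5
(a +√5· b) ⊗ (c +√5· d) =
  (a ℚ.* c ℚ.+ 5ℚ ℚ.* b ℚ.* d) +√5· (a ℚ.* d ℚ.+ b ℚ.* c)
  where 5ℚ = + 5 ℚ./ 1

-- multiplicative inverse: (a + b√5)⁻¹ = (a - b√5)/(a² - 5b²)
inv : Q5 → Q5
inv (a +√5· b) = (a ℚ.* r) +√5· (ℚ.- b ℚ.* r)
  where r = recipℚ (a ℚ.* a ℚ.- (+ 5 ℚ./ 1) ℚ.* b ℚ.* b)

powℕ : Q5 → ℕ → Q5
powℕ x zero = fromℚ 1ℚ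
powℕ x (suc n) = x ⊗ powℕ x n

pow : Q5 → ℤ → Q5
pow x (+ n) = powℕ x n
pow x -[1+ n ] = powℕ (inv x) (suc n)

Φ : Q5
Φ = ½ +√5· ½

-- strict positivity of a + b√5 as a real number
Positive : Q5 → Set
Positive (a +√5· b) =
    (0ℚ ℚ.< a × 0ℚ ℚ.≤ b)
  ⊎ (0ℚ ℚ.≤ a × 0ℚ ℚ.< b)
  ⊎ (0ℚ ℚ.< a × b ℚ.< 0ℚ × (+ 5 ℚ./ 1) ℚ.* b ℚ.* b ℚ.< a ℚ.* a)
  ⊎ (a ℚ.< 0ℚ × 0ℚ ℚ.< b × a ℚ.* a ℚ.< (+ 5 ℚ./ 1) ℚ.* b ℚ.* b)

_≺_ : Q5 → Q5 → Set
x ≺ y = Positive (y ⊖ x)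

Close : Q5 → Q5 → ℚ → Set
Close x L ε = ((x ⊖ L) ≺ fromℚ ε) × ((⊝ fromℚ ε) ≺ (x ⊖ L))

sumFrom1 : (ℕ → ℚ) → ℕ → ℚ
sumFrom1 a zero = 0ℚ
sumFrom1 a (suc m) = sumFrom1 a m ℚ.+ a (suc m)

SeriesConvergesTo : (ℕ → ℚ) → Q5 → Set
SeriesConvergesTo a L =
  (ε : ℚ) → 0ℚ ℚ.< ε →
  Σ ℕ λ N → (m : ℕ) → N ℕ.≤ m → Close (fromℚ (sumFrom1 a m)) L ε
  where open import Data.Product using (Σ)

{-# OPTIONS --safe #-}

-- By the d'Ocagne-type identity L_x F_y − F_x L_y = 2(−1)^x F_{y−x}, the n-th term equals
-- ½ (L_{u_n}/F_{u_n} − L_{u_{n+k}}/F_{u_{n+k}}), so the m-th partial sum telescopes to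
-- ½ (Σ_{j≤k} L_{u_j}/F_{u_j} − Σ_{j≤k} L_{u_{m+j}}/F_{u_{m+j}}).  On the other side, the
-- addition formula 2F_{x+t} = L_t F_x + F_t L_x and Φ^t = (L_t + F_t √5)/2 turn the claimed
-- limit into ½ Σ_{j≤k} L_{u_j}/F_{u_j} − (k/2) √5, whatever t is.  It remains that
-- L_x/F_x → √5: as L_x² − 5F_x² = ±4, once F_x ≥ F_{2p+1} the ratio L_x/F_x lies between
-- its values at 2p+1 and at 2p, which bracket √5 and differ by 2/(F_{2p} F_{2p+1}).

module Submission where

open import Defs
open import Data.Nat as ℕ using (ℕ; zero; suc; _≤_; _+_; z≤n; s≤s)
import Data.Nat.Properties as ℕP
import Data.Nat.Tactic.RingSolver as ℕS
open import Data.Integer as ℤ using (ℤ; +_; -[1+_])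
import Data.Integer.Properties as ℤP
import Data.Integer.Tactic.RingSolver as ℤS
open import Data.Rational as ℚ using (ℚ; 0ℚ; 1ℚ; ½; toℚᵘ)
import Data.Rational.Properties as ℚP
import Data.Rational.Unnormalised as ℚᵘ
import Data.Rational.Unnormalised.Properties as ℚᵘP
open import Data.Product using (Σ; _×_; _,_; proj₁; proj₂)
open import Data.Sum using (_⊎_; inj₁; inj₂)
open import Relation.Binary.Definitions using (tri<; tri≈; tri>)
open import Data.Empty using (⊥-elim)
open import Level using (0ℓ)
open import Relation.Nullary.Decidable.Core using (dec⇒maybe)
open import Relation.Binary.PropositionalEquality
open import Tactic.RingSolver using (solve-∀)
import Tactic.RingSolver.Core.AlmostCommutativeRing as ACR

ℚ-ring : ACR.AlmostCommutativeRing 0ℓ 0ℓ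
ℚ-ring = ACR.fromCommutativeRing ℚP.+-*-commutativeRing λ q → dec⇒maybe (0ℚ ℚP.≟ q)

fromℤ : ℤ → ℚ
fromℤ a = a ℚ./ 1

toℚᵘ-fromℤ : ∀ a → toℚᵘ (fromℤ a) ℚᵘ.≃ ℚᵘ.mkℚᵘ a 0
toℚᵘ-fromℤ a = ℚP.toℚᵘ-fromℚᵘ (ℚᵘ.mkℚᵘ a 0)

fromℤ-homo-+ : ∀ a b → fromℤ (a ℤ.+ b) ≡ fromℤ a ℚ.+ fromℤ b
fromℤ-homo-+ a b = ℚP.toℚᵘ-injective (begin
  toℚᵘ (fromℤ (a ℤ.+ b))                    ≈⟨ toℚᵘ-fromℤ (a ℤ.+ b) ⟩
  ℚᵘ.mkℚᵘ (a ℤ.+ b) 0                        ≈⟨ ℚᵘ.*≡* (eq a b) ⟩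
  ℚᵘ.mkℚᵘ a 0 ℚᵘ.+ ℚᵘ.mkℚᵘ b 0              ≈⟨ ℚᵘP.+-cong (toℚᵘ-fromℤ a) (toℚᵘ-fromℤ b) ⟨
  toℚᵘ (fromℤ a) ℚᵘ.+ toℚᵘ (fromℤ b)        ≈⟨ ℚP.toℚᵘ-homo-+ (fromℤ a) (fromℤ b) ⟨
  toℚᵘ (fromℤ a ℚ.+ fromℤ b)                ∎)
  where
  open ℚᵘP.≃-Reasoning
  eq : ∀ a b → (a ℤ.+ b) ℤ.* + 1 ≡ (a ℤ.* + 1 ℤ.+ b ℤ.* + 1) ℤ.* + 1
  eq = ℤS.solve-∀

fromℤ-homo-* : ∀ a b → fromℤ (a ℤ.* b) ≡ fromℤ a ℚ.* fromℤ b
fromℤ-homo-* a b = ℚP.toℚᵘ-injective (begin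
  toℚᵘ (fromℤ (a ℤ.* b))                    ≈⟨ toℚᵘ-fromℤ (a ℤ.* b) ⟩
  ℚᵘ.mkℚᵘ (a ℤ.* b) 0                        ≈⟨ ℚᵘ.*≡* (eq a b) ⟩
  ℚᵘ.mkℚᵘ a 0 ℚᵘ.* ℚᵘ.mkℚᵘ b 0              ≈⟨ ℚᵘP.*-cong (toℚᵘ-fromℤ a) (toℚᵘ-fromℤ b) ⟨
  toℚᵘ (fromℤ a) ℚᵘ.* toℚᵘ (fromℤ b)        ≈⟨ ℚP.toℚᵘ-homo-* (fromℤ a) (fromℤ b) ⟨
  toℚᵘ (fromℤ a ℚ.* fromℤ b)                ∎)
  where
  open ℚᵘP.≃-Reasoning
  eq : ∀ a b → (a ℤ.* b) ℤ.* + 1 ≡ (a ℤ.* b) ℤ.* + 1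
  eq _ _ = refl

fromℤ-homo‿- : ∀ a → fromℤ (ℤ.- a) ≡ ℚ.- fromℤ a
fromℤ-homo‿- a = ℚP.toℚᵘ-injective (begin
  toℚᵘ (fromℤ (ℤ.- a))       ≈⟨ toℚᵘ-fromℤ (ℤ.- a) ⟩
  ℚᵘ.mkℚᵘ (ℤ.- a) 0          ≈⟨ ℚᵘP.-‿cong (toℚᵘ-fromℤ a) ⟨
  ℚᵘ.- toℚᵘ (fromℤ a)        ≈⟨ ℚP.toℚᵘ-homo‿- (fromℤ a) ⟨
  toℚᵘ (ℚ.- fromℤ a)         ∎)
  where open ℚᵘP.≃-Reasoning

fromℤ-homo-- : ∀ a b → fromℤ (a ℤ.- b) ≡ fromℤ a ℚ.- fromℤ b
fromℤ-homo-- a b = trans (fromℤ-homo-+ a (ℤ.- b)) (cong (fromℤ a ℚ.+_) (fromℤ-homo‿- b))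

½*fromℤ-double : ∀ a → ½ ℚ.* fromℤ (+ 2 ℤ.* a) ≡ fromℤ a
½*fromℤ-double a = trans (cong (½ ℚ.*_) (fromℤ-homo-* (+ 2) a)) (halve (fromℤ a))
  where
  halve : ∀ x → ½ ℚ.* (fromℤ (+ 2) ℚ.* x) ≡ x
  halve = solve-∀ ℚ-ring

divℤ-*ʳ : ∀ a {b} → b ≢ + 0 → divℤ a b ℚ.* fromℤ b ≡ fromℤ a
divℤ-*ʳ a {+ zero} b≢0 = ⊥-elim (b≢0 refl)
divℤ-*ʳ a {+ suc m} _ = ℚP.toℚᵘ-injective (begin
  toℚᵘ (a ℚ./ suc m ℚ.* fromℤ (+ suc m))           ≈⟨ ℚP.toℚᵘ-homo-* (a ℚ./ suc m) (fromℤ (+ suc m)) ⟩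
  toℚᵘ (a ℚ./ suc m) ℚᵘ.* toℚᵘ (fromℤ (+ suc m))   ≈⟨ ℚᵘP.*-cong (ℚP.toℚᵘ-fromℚᵘ (ℚᵘ.mkℚᵘ a m)) (toℚᵘ-fromℤ (+ suc m)) ⟩
  ℚᵘ.mkℚᵘ a m ℚᵘ.* ℚᵘ.mkℚᵘ (+ suc m) 0              ≈⟨ ℚᵘ.*≡* eq ⟩
  ℚᵘ.mkℚᵘ a 0                                       ≈⟨ toℚᵘ-fromℤ a ⟨
  toℚᵘ (fromℤ a)                                    ∎)
  where
  open ℚᵘP.≃-Reasoning
  eq : a ℤ.* + suc m ℤ.* + 1 ≡ a ℤ.* + suc (m ℕ.* 1)
  eq rewrite ℕP.*-identityʳ m = ℤP.*-identityʳ (a ℤ.* + suc m)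
divℤ-*ʳ a { -[1+ m ]} _ = ℚP.toℚᵘ-injective (begin
  toℚᵘ ((ℤ.- a) ℚ./ suc m ℚ.* fromℤ -[1+ m ])           ≈⟨ ℚP.toℚᵘ-homo-* ((ℤ.- a) ℚ./ suc m) (fromℤ -[1+ m ]) ⟩
  toℚᵘ ((ℤ.- a) ℚ./ suc m) ℚᵘ.* toℚᵘ (fromℤ -[1+ m ])   ≈⟨ ℚᵘP.*-cong (ℚP.toℚᵘ-fromℚᵘ (ℚᵘ.mkℚᵘ (ℤ.- a) m)) (toℚᵘ-fromℤ -[1+ m ]) ⟩
  ℚᵘ.mkℚᵘ (ℤ.- a) m ℚᵘ.* ℚᵘ.mkℚᵘ -[1+ m ] 0              ≈⟨ ℚᵘ.*≡* eq ⟩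
  ℚᵘ.mkℚᵘ a 0                                           ≈⟨ toℚᵘ-fromℤ a ⟨
  toℚᵘ (fromℤ a)                                        ∎)
  where
  open ℚᵘP.≃-Reasoning
  l : ∀ a b → (ℤ.- a) ℤ.* (ℤ.- b) ℤ.* + 1 ≡ a ℤ.* b
  l = ℤS.solve-∀
  eq : (ℤ.- a) ℤ.* -[1+ m ] ℤ.* + 1 ≡ a ℤ.* + suc (m ℕ.* 1)
  eq rewrite ℕP.*-identityʳ m = l a (+ suc m)

divℤ-unique : ∀ {a b q} → b ≢ + 0 → q ℚ.* fromℤ b ≡ fromℤ a → divℤ a b ≡ q
divℤ-unique {a} {b} {q} b≢0 q*b≡a = begin
  divℤ a b                        ≡⟨ cancel (divℤ a b) ⟨
  divℤ a b ℚ.* fromℤ b ℚ.* b⁻¹     ≡⟨ cong (ℚ._* b⁻¹) (trans (divℤ-*ʳ a b≢0) (sym q*b≡a)) ⟩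
  q ℚ.* fromℤ b ℚ.* b⁻¹            ≡⟨ cancel q ⟩
  q                               ∎
  where
  open ≡-Reasoning
  b⁻¹ = divℤ (+ 1) b
  cancel : ∀ x → x ℚ.* fromℤ b ℚ.* b⁻¹ ≡ x
  cancel x = begin
    x ℚ.* fromℤ b ℚ.* b⁻¹   ≡⟨ ℚP.*-assoc x (fromℤ b) b⁻¹ ⟩
    x ℚ.* (fromℤ b ℚ.* b⁻¹) ≡⟨ cong (x ℚ.*_) (trans (ℚP.*-comm (fromℤ b) b⁻¹) (divℤ-*ʳ (+ 1) b≢0)) ⟩
    x ℚ.* 1ℚ                ≡⟨ ℚP.*-identityʳ x ⟩
    x                       ∎

*-≢0 : ∀ {a b} → a ≢ + 0 → b ≢ + 0 → a ℤ.* b ≢ + 0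
*-≢0 {a} a≢0 b≢0 ab≡0 with ℤP.i*j≡0⇒i≡0∨j≡0 a ab≡0
... | inj₁ a≡0 = a≢0 a≡0
... | inj₂ b≡0 = b≢0 b≡0

divℤ-* : ∀ a c {b d} → b ≢ + 0 → d ≢ + 0 → divℤ a b ℚ.* divℤ c d ≡ divℤ (a ℤ.* c) (b ℤ.* d)
divℤ-* a c {b} {d} b≢0 d≢0 = sym (divℤ-unique (*-≢0 b≢0 d≢0) (begin
  divℤ a b ℚ.* divℤ c d ℚ.* fromℤ (b ℤ.* d)                ≡⟨ cong (divℤ a b ℚ.* divℤ c d ℚ.*_) (fromℤ-homo-* b d) ⟩
  divℤ a b ℚ.* divℤ c d ℚ.* (fromℤ b ℚ.* fromℤ d)          ≡⟨ interchange (divℤ a b) (divℤ c d) (fromℤ b) (fromℤ d) ⟩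
  (divℤ a b ℚ.* fromℤ b) ℚ.* (divℤ c d ℚ.* fromℤ d)        ≡⟨ cong₂ ℚ._*_ (divℤ-*ʳ a b≢0) (divℤ-*ʳ c d≢0) ⟩
  fromℤ a ℚ.* fromℤ c                                     ≡⟨ fromℤ-homo-* a c ⟨
  fromℤ (a ℤ.* c)                                         ∎))
  where
  open ≡-Reasoning
  interchange : ∀ x y u v → x ℚ.* y ℚ.* (u ℚ.* v) ≡ (x ℚ.* u) ℚ.* (y ℚ.* v)
  interchange = solve-∀ ℚ-ring

fromℤ*divℤ : ∀ a c {b} → b ≢ + 0 → fromℤ a ℚ.* divℤ c b ≡ divℤ (a ℤ.* c) b
fromℤ*divℤ a c {b} b≢0 = sym (divℤ-unique b≢0 (begin
  fromℤ a ℚ.* divℤ c b ℚ.* fromℤ b     ≡⟨ ℚP.*-assoc (fromℤ a) (divℤ c b) (fromℤ b) ⟩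
  fromℤ a ℚ.* (divℤ c b ℚ.* fromℤ b)   ≡⟨ cong (fromℤ a ℚ.*_) (divℤ-*ʳ c b≢0) ⟩
  fromℤ a ℚ.* fromℤ c                  ≡⟨ fromℤ-homo-* a c ⟨
  fromℤ (a ℤ.* c)                      ∎))
  where open ≡-Reasoning

divℤ-mono-≤ : ∀ a c {b d} → + 0 ℤ.< b → + 0 ℤ.< d → a ℤ.* d ℤ.≤ c ℤ.* b → divℤ a b ℚ.≤ divℤ c d
divℤ-mono-≤ a c {+ suc m} {+ suc n} _ _ ad≤cb = ℚP.toℚᵘ-cancel-≤
  (ℚᵘP.≤-respˡ-≃ (ℚᵘP.≃-sym (ℚP.toℚᵘ-fromℚᵘ (ℚᵘ.mkℚᵘ a m)))
    (ℚᵘP.≤-respʳ-≃ (ℚᵘP.≃-sym (ℚP.toℚᵘ-fromℚᵘ (ℚᵘ.mkℚᵘ c n))) (ℚᵘ.*≤* ad≤cb)))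
divℤ-mono-≤ a c {+ zero} (ℤ.+<+ ()) _ _
divℤ-mono-≤ a c {+ suc _} {+ zero} _ (ℤ.+<+ ()) _

divℤ-mono-< : ∀ a c {b d} → + 0 ℤ.< b → + 0 ℤ.< d → a ℤ.* d ℤ.< c ℤ.* b → divℤ a b ℚ.< divℤ c d
divℤ-mono-< a c {+ suc m} {+ suc n} _ _ ad<cb = ℚP.toℚᵘ-cancel-<
  (ℚᵘP.<-respˡ-≃ (ℚᵘP.≃-sym (ℚP.toℚᵘ-fromℚᵘ (ℚᵘ.mkℚᵘ a m)))
    (ℚᵘP.<-respʳ-≃ (ℚᵘP.≃-sym (ℚP.toℚᵘ-fromℚᵘ (ℚᵘ.mkℚᵘ c n))) (ℚᵘ.*<* ad<cb)))
divℤ-mono-< a c {+ zero} (ℤ.+<+ ()) _ _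
divℤ-mono-< a c {+ suc _} {+ zero} _ (ℤ.+<+ ()) _

divℕ-mono-≤ : ∀ a b c d → 1 ≤ b → 1 ≤ d → a ℕ.* d ≤ c ℕ.* b → divℤ (+ a) (+ b) ℚ.≤ divℤ (+ c) (+ d)
divℕ-mono-≤ a b c d 1≤b 1≤d ad≤cb = divℤ-mono-≤ (+ a) (+ c) (ℤ.+<+ 1≤b) (ℤ.+<+ 1≤d)
  (subst₂ ℤ._≤_ (ℤP.pos-* a d) (ℤP.pos-* c b) (ℤ.+≤+ ad≤cb))

divℕ<ε : ∀ {ε} k B → 0ℚ ℚ.< ε → k ℕ.* ℚ.↧ₙ ε ℕ.< B → divℤ (+ k) (+ B) ℚ.< ε
divℕ<ε {ε@(ℚ.mkℚ (+ suc n) d _)} k B _ kD<B = subst (divℤ (+ k) (+ B) ℚ.<_) (ℚP.↥p/↧p≡p ε)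
  (divℤ-mono-< (+ k) (+ suc n) (ℤ.+<+ (ℕP.≤-trans (s≤s z≤n) kD<B)) (ℤ.+<+ (s≤s z≤n))
    (subst₂ ℤ._<_ (ℤP.pos-* k (suc d)) (ℤP.pos-* (suc n) B)
      (ℤ.+<+ (ℕP.<-≤-trans kD<B (ℕP.m≤n*m B (suc n))))))
divℕ<ε {ℚ.mkℚ (+ zero) _ _} k B (ℚ.*<* (ℤ.+<+ ())) _
divℕ<ε {ℚ.mkℚ -[1+ _ ] _ _} k B (ℚ.*<* ()) _

x<y⇒0<y-x : ∀ {x y} → x ℚ.< y → 0ℚ ℚ.< y ℚ.- x
x<y⇒0<y-x {x} {y} x<y = subst (ℚ._< y ℚ.- x) (ℚP.+-inverseʳ x) (ℚP.+-monoˡ-< (ℚ.- x) x<y)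

0<x+y⇒-x<y : ∀ {x y} → 0ℚ ℚ.< x ℚ.+ y → ℚ.- x ℚ.< y
0<x+y⇒-x<y {x} {y} 0<x+y =
  subst₂ ℚ._<_ (ℚP.+-identityˡ (ℚ.- x)) (cancel x y) (ℚP.+-monoˡ-< (ℚ.- x) 0<x+y)
  where
  cancel : ∀ x y → x ℚ.+ y ℚ.- x ≡ y
  cancel = solve-∀ ℚ-ring

0<b*l⇒0<b : ∀ {b l} → 0ℚ ℚ.≤ l → 0ℚ ℚ.< b ℚ.* l → 0ℚ ℚ.< b
0<b*l⇒0<b {b} {l} 0≤l 0<bl = ℚP.≰⇒> λ b≤0 →
  ℚP.<-irrefl refl (ℚP.<-≤-trans 0<bl
    (subst (b ℚ.* l ℚ.≤_) (ℚP.*-zeroˡ l) (ℚP.*-monoʳ-≤-nonNeg l {{ℚ.nonNegative 0≤l}} b≤0)))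

nonNeg*nonNeg : ∀ {p q} → 0ℚ ℚ.≤ p → 0ℚ ℚ.≤ q → 0ℚ ℚ.≤ p ℚ.* q
nonNeg*nonNeg {p} {q} 0≤p 0≤q =
  ℚP.nonNegative⁻¹ _ {{ℚP.nonNeg*nonNeg⇒nonNeg p {{ℚ.nonNegative 0≤p}} q {{ℚ.nonNegative 0≤q}}}}

square-mono-< : ∀ {p q} → 0ℚ ℚ.≤ p → p ℚ.< q → p ℚ.* p ℚ.< q ℚ.* q
square-mono-< {p} {q} 0≤p p<q = ℚP.≤-<-trans
  (ℚP.*-monoˡ-≤-nonNeg p {{ℚ.nonNegative 0≤p}} (ℚP.<⇒≤ p<q))
  (ℚP.*-monoˡ-<-pos q {{ℚ.positive (ℚP.≤-<-trans 0≤p p<q)}} p<q)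

sumFrom1-cong : ∀ {f g} m → (∀ n → 1 ≤ n → f n ≡ g n) → sumFrom1 f m ≡ sumFrom1 g m
sumFrom1-cong zero _ = refl
sumFrom1-cong (suc m) f≡g = cong₂ ℚ._+_ (sumFrom1-cong m f≡g) (f≡g (suc m) (s≤s z≤n))

sumFrom1-mono-≤ : ∀ {f g} m → (∀ n → 1 ≤ n → f n ℚ.≤ g n) → sumFrom1 f m ℚ.≤ sumFrom1 g m
sumFrom1-mono-≤ zero _ = ℚP.≤-refl
sumFrom1-mono-≤ (suc m) f≤g = ℚP.+-mono-≤ (sumFrom1-mono-≤ m f≤g) (f≤g (suc m) (s≤s z≤n))

sumFrom1-const : ∀ c m → sumFrom1 (λ _ → c) m ≡ fromℤ (+ m) ℚ.* c
sumFrom1-const c zero = sym (ℚP.*-zeroˡ c)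
sumFrom1-const c (suc m) = begin
  sumFrom1 (λ _ → c) m ℚ.+ c                ≡⟨ cong (ℚ._+ c) (sumFrom1-const c m) ⟩
  fromℤ (+ m) ℚ.* c ℚ.+ c                   ≡⟨ collect (fromℤ (+ m)) c ⟩
  (fromℤ (+ 1) ℚ.+ fromℤ (+ m)) ℚ.* c       ≡⟨ cong (ℚ._* c) (fromℤ-homo-+ (+ 1) (+ m)) ⟨
  fromℤ (+ suc m) ℚ.* c                     ∎
  where
  open ≡-Reasoning
  collect : ∀ x c → x ℚ.* c ℚ.+ c ≡ (fromℤ (+ 1) ℚ.+ x) ℚ.* c
  collect = solve-∀ ℚ-ring

sumFrom1-*ˡ : ∀ c f m → sumFrom1 (λ n → c ℚ.* f n) m ≡ c ℚ.* sumFrom1 f m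
sumFrom1-*ˡ c f zero = sym (ℚP.*-zeroʳ c)
sumFrom1-*ˡ c f (suc m) =
  trans (cong (ℚ._+ c ℚ.* f (suc m)) (sumFrom1-*ˡ c f m)) (sym (ℚP.*-distribˡ-+ c (sumFrom1 f m) (f (suc m))))

sumFrom1-+ : ∀ f g m → sumFrom1 (λ n → f n ℚ.+ g n) m ≡ sumFrom1 f m ℚ.+ sumFrom1 g m
sumFrom1-+ f g zero = refl
sumFrom1-+ f g (suc m) =
  trans (cong (ℚ._+ (f (suc m) ℚ.+ g (suc m))) (sumFrom1-+ f g m)) (swap (sumFrom1 f m) (sumFrom1 g m) (f (suc m)) (g (suc m)))
  where
  swap : ∀ a b c d → a ℚ.+ b ℚ.+ (c ℚ.+ d) ≡ a ℚ.+ c ℚ.+ (b ℚ.+ d)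
  swap = solve-∀ ℚ-ring

sumFrom1-suc : ∀ f k → sumFrom1 f k ℚ.+ f (suc k) ≡ f 1 ℚ.+ sumFrom1 (λ j → f (suc j)) k
sumFrom1-suc f zero = trans (ℚP.+-identityˡ (f 1)) (sym (ℚP.+-identityʳ (f 1)))
sumFrom1-suc f (suc k) = trans (cong (ℚ._+ f (suc (suc k))) (sumFrom1-suc f k))
                               (ℚP.+-assoc (f 1) (sumFrom1 (λ j → f (suc j)) k) (f (suc (suc k))))

sumFrom1-telescope : ∀ c k m →
  sumFrom1 (λ n → c n ℚ.- c (n + k)) m ≡ sumFrom1 c k ℚ.- sumFrom1 (λ j → c (m + j)) k
sumFrom1-telescope c k zero = sym (ℚP.+-inverseʳ (sumFrom1 c k))
sumFrom1-telescope c k (suc m) = begin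
  sumFrom1 (λ n → c n ℚ.- c (n + k)) m ℚ.+ (c (suc m) ℚ.- c (suc m + k))
      ≡⟨ cong (ℚ._+ (c (suc m) ℚ.- c (suc m + k))) (sumFrom1-telescope c k m) ⟩
  R ℚ.- T ℚ.+ (c (suc m) ℚ.- c (suc (m + k)))
      ≡⟨ rearrange R T (c (suc m)) (c (suc (m + k))) ⟩
  R ℚ.- (T ℚ.+ c (suc (m + k)) ℚ.- c (suc m))
      ≡⟨ cong₂ (λ a b → R ℚ.- (T ℚ.+ c a ℚ.- c b)) (ℕP.+-suc m k) (ℕP.+-comm m 1) ⟨
  R ℚ.- (T ℚ.+ c (m + suc k) ℚ.- c (m + 1))
      ≡⟨ cong (λ w → R ℚ.- (w ℚ.- c (m + 1))) (sumFrom1-suc (λ j → c (m + j)) k) ⟩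
  R ℚ.- (c (m + 1) ℚ.+ T′ ℚ.- c (m + 1))
      ≡⟨ cong (λ w → R ℚ.- w) (cancel (c (m + 1)) T′) ⟩
  R ℚ.- T′
      ≡⟨ cong (λ w → R ℚ.- w) (sumFrom1-cong k (λ j _ → cong c (ℕP.+-suc m j))) ⟩
  R ℚ.- sumFrom1 (λ j → c (suc m + j)) k ∎
  where
  open ≡-Reasoning
  R = sumFrom1 c k
  T = sumFrom1 (λ j → c (m + j)) k
  T′ = sumFrom1 (λ j → c (m + suc j)) k
  rearrange : ∀ R T a b → R ℚ.- T ℚ.+ (a ℚ.- b) ≡ R ℚ.- (T ℚ.+ b ℚ.- a)
  rearrange = solve-∀ ℚ-ring
  cancel : ∀ a T → a ℚ.+ T ℚ.- a ≡ T
  cancel = solve-∀ ℚ-ring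

_≤√5 : ℚ → Set
l ≤√5 = 0ℚ ℚ.≤ l × l ℚ.* l ℚ.≤ fromℤ (+ 5)

√5≤_ : ℚ → Set
√5≤ h = 0ℚ ℚ.≤ h × fromℤ (+ 5) ℚ.≤ h ℚ.* h

lower√5⇒Positive : ∀ {a b l} → 0ℚ ℚ.≤ b → l ≤√5 → 0ℚ ℚ.< a ℚ.+ b ℚ.* l → Positive (a +√5· b)
lower√5⇒Positive {a} {b} {l} 0≤b (0≤l , l²≤5) 0<a+bl with ℚP.<-cmp 0ℚ a
... | tri< 0<a _ _ = inj₁ (0<a , 0≤b)
... | tri≈ _ refl _ =
  inj₂ (inj₁ (ℚP.≤-refl , 0<b*l⇒0<b 0≤l (subst (0ℚ ℚ.<_) (ℚP.+-identityˡ (b ℚ.* l)) 0<a+bl)))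
... | tri> _ _ a<0 = inj₂ (inj₂ (inj₂ (a<0 , 0<b*l⇒0<b 0≤l 0<bl , a²<5b²)))
  where
  open ℚP.≤-Reasoning
  0<-a : 0ℚ ℚ.< ℚ.- a
  0<-a = ℚP.neg-antimono-< a<0
  -a<bl : ℚ.- a ℚ.< b ℚ.* l
  -a<bl = 0<x+y⇒-x<y 0<a+bl
  0<bl : 0ℚ ℚ.< b ℚ.* l
  0<bl = ℚP.<-trans 0<-a -a<bl
  neg*neg : ∀ a → ℚ.- a ℚ.* ℚ.- a ≡ a ℚ.* a
  neg*neg = solve-∀ ℚ-ring
  regroup : ∀ b l → b ℚ.* l ℚ.* (b ℚ.* l) ≡ b ℚ.* b ℚ.* (l ℚ.* l)
  regroup = solve-∀ ℚ-ring
  reorder : ∀ b c → b ℚ.* b ℚ.* c ≡ c ℚ.* b ℚ.* b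
  reorder = solve-∀ ℚ-ring
  a²<5b² : a ℚ.* a ℚ.< fromℤ (+ 5) ℚ.* b ℚ.* b
  a²<5b² = begin-strict
    a ℚ.* a                   ≡⟨ neg*neg a ⟨
    ℚ.- a ℚ.* ℚ.- a           <⟨ square-mono-< (ℚP.<⇒≤ 0<-a) -a<bl ⟩
    b ℚ.* l ℚ.* (b ℚ.* l)     ≡⟨ regroup b l ⟩
    b ℚ.* b ℚ.* (l ℚ.* l)     ≤⟨ ℚP.*-monoˡ-≤-nonNeg (b ℚ.* b) {{ℚ.nonNegative (nonNeg*nonNeg 0≤b 0≤b)}} l²≤5 ⟩
    b ℚ.* b ℚ.* fromℤ (+ 5)   ≡⟨ reorder b (fromℤ (+ 5)) ⟩
    fromℤ (+ 5) ℚ.* b ℚ.* b   ∎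

upper√5⇒Positive : ∀ {a b h} → b ℚ.≤ 0ℚ → √5≤ h → 0ℚ ℚ.< a ℚ.+ b ℚ.* h → Positive (a +√5· b)
upper√5⇒Positive {a} {b} {h} b≤0 (0≤h , 5≤h²) 0<a+bh with ℚP.<-cmp b 0ℚ
... | tri≈ _ refl _ = inj₁ (subst (0ℚ ℚ.<_) (drop a h) 0<a+bh , ℚP.≤-refl)
  where
  drop : ∀ a h → a ℚ.+ 0ℚ ℚ.* h ≡ a
  drop = solve-∀ ℚ-ring
... | tri> _ _ 0<b = ⊥-elim (ℚP.<-irrefl refl (ℚP.<-≤-trans 0<b b≤0))
... | tri< b<0 _ _ = inj₂ (inj₂ (inj₁ (0<a , b<0 , 5b²<a²)))
  where
  open ℚP.≤-Reasoning
  0≤-b : 0ℚ ℚ.≤ ℚ.- b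
  0≤-b = ℚP.<⇒≤ (ℚP.neg-antimono-< b<0)
  -bh<a : ℚ.- b ℚ.* h ℚ.< a
  -bh<a = subst (ℚ._< a) (ℚP.neg-distribˡ-* b h)
    (0<x+y⇒-x<y (subst (0ℚ ℚ.<_) (ℚP.+-comm a (b ℚ.* h)) 0<a+bh))
  0≤-bh : 0ℚ ℚ.≤ ℚ.- b ℚ.* h
  0≤-bh = nonNeg*nonNeg 0≤-b 0≤h
  0<a : 0ℚ ℚ.< a
  0<a = ℚP.≤-<-trans 0≤-bh -bh<a
  reorder : ∀ b c → c ℚ.* b ℚ.* b ≡ ℚ.- b ℚ.* ℚ.- b ℚ.* c
  reorder = solve-∀ ℚ-ring
  regroup : ∀ b h → ℚ.- b ℚ.* ℚ.- b ℚ.* (h ℚ.* h) ≡ ℚ.- b ℚ.* h ℚ.* (ℚ.- b ℚ.* h)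
  regroup = solve-∀ ℚ-ring
  5b²<a² : fromℤ (+ 5) ℚ.* b ℚ.* b ℚ.< a ℚ.* a
  5b²<a² = begin-strict
    fromℤ (+ 5) ℚ.* b ℚ.* b                ≡⟨ reorder b (fromℤ (+ 5)) ⟩
    ℚ.- b ℚ.* ℚ.- b ℚ.* fromℤ (+ 5)        ≤⟨ ℚP.*-monoˡ-≤-nonNeg (ℚ.- b ℚ.* ℚ.- b) {{ℚ.nonNegative (nonNeg*nonNeg 0≤-b 0≤-b)}} 5≤h² ⟩
    ℚ.- b ℚ.* ℚ.- b ℚ.* (h ℚ.* h)          ≡⟨ regroup b h ⟩
    ℚ.- b ℚ.* h ℚ.* (ℚ.- b ℚ.* h)          <⟨ square-mono-< 0≤-bh -bh<a ⟩
    a ℚ.* a                                ∎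

Positive-resp : ∀ {a b a′ b′} → a ≡ a′ → b ≡ b′ → Positive (a +√5· b) → Positive (a′ +√5· b′)
Positive-resp refl refl p = p

Close-resp : ∀ ε x L y M → re (x ⊖ L) ≡ re (y ⊖ M) → im (x ⊖ L) ≡ im (y ⊖ M) →
             Close y M ε → Close x L ε
Close-resp ε x L y M re≡ im≡ = subst (λ d → (d ≺ fromℚ ε) × ((⊝ fromℚ ε) ≺ d)) (sym (cong₂ _+√5·_ re≡ im≡))

√5-bracket⇒Close : ∀ {c q lo hi ε} → 0ℚ ℚ.≤ c → lo ≤√5 → √5≤ hi →
                   c ℚ.* lo ℚ.≤ q → q ℚ.≤ c ℚ.* hi → c ℚ.* (hi ℚ.- lo) ℚ.< ε →
                   Close (0ℚ +√5· c) (fromℚ q) ε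
√5-bracket⇒Close {c} {q} {lo} {hi} {ε} 0≤c lo≤√5 √5≤hi clo≤q q≤chi gap =
    Positive-resp (e₁ ε q) (e₂ c) (upper√5⇒Positive (ℚP.neg-antimono-≤ 0≤c) √5≤hi 0<ε+q-chi)
  , Positive-resp (e₃ ε q) (e₄ c) (lower√5⇒Positive 0≤c lo≤√5 0<ε-q+clo)
  where
  open ℚP.≤-Reasoning
  0<ε-gap : 0ℚ ℚ.< ε ℚ.- c ℚ.* (hi ℚ.- lo)
  0<ε-gap = x<y⇒0<y-x gap
  split : ∀ ε c hi lo → ε ℚ.- c ℚ.* (hi ℚ.- lo) ≡ ε ℚ.- c ℚ.* hi ℚ.+ c ℚ.* lo
  split = solve-∀ ℚ-ring
  e₀ : ∀ ε c hi q → ε ℚ.- c ℚ.* hi ℚ.+ q ≡ ε ℚ.+ q ℚ.+ ℚ.- c ℚ.* hi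
  e₀ = solve-∀ ℚ-ring
  0<ε+q-chi : 0ℚ ℚ.< ε ℚ.+ q ℚ.+ ℚ.- c ℚ.* hi
  0<ε+q-chi = begin-strict
    0ℚ                               <⟨ 0<ε-gap ⟩
    ε ℚ.- c ℚ.* (hi ℚ.- lo)           ≡⟨ split ε c hi lo ⟩
    ε ℚ.- c ℚ.* hi ℚ.+ c ℚ.* lo       ≤⟨ ℚP.+-monoʳ-≤ (ε ℚ.- c ℚ.* hi) clo≤q ⟩
    ε ℚ.- c ℚ.* hi ℚ.+ q              ≡⟨ e₀ ε c hi q ⟩
    ε ℚ.+ q ℚ.+ ℚ.- c ℚ.* hi          ∎
  0<ε-q+clo : 0ℚ ℚ.< ε ℚ.- q ℚ.+ c ℚ.* lo
  0<ε-q+clo = begin-strict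
    0ℚ                               <⟨ 0<ε-gap ⟩
    ε ℚ.- c ℚ.* (hi ℚ.- lo)           ≡⟨ split ε c hi lo ⟩
    ε ℚ.- c ℚ.* hi ℚ.+ c ℚ.* lo       ≤⟨ ℚP.+-monoˡ-≤ (c ℚ.* lo) (ℚP.+-monoʳ-≤ ε (ℚP.neg-antimono-≤ q≤chi)) ⟩
    ε ℚ.- q ℚ.+ c ℚ.* lo              ∎
  e₁ : ∀ ε q → ε ℚ.+ q ≡ ε ℚ.+ ℚ.- (0ℚ ℚ.+ ℚ.- q)
  e₁ = solve-∀ ℚ-ring
  e₂ : ∀ c → ℚ.- c ≡ 0ℚ ℚ.+ ℚ.- (c ℚ.+ ℚ.- 0ℚ)
  e₂ = solve-∀ ℚ-ring
  e₃ : ∀ ε q → ε ℚ.- q ≡ 0ℚ ℚ.+ ℚ.- q ℚ.+ ℚ.- (ℚ.- ε)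
  e₃ = solve-∀ ℚ-ring
  e₄ : ∀ c → c ≡ c ℚ.+ ℚ.- 0ℚ ℚ.+ ℚ.- (ℚ.- 0ℚ)
  e₄ = solve-∀ ℚ-ring

record IsFibonacciLike (G : ℤ → ℤ) : Set where
  constructor fibonacciLike
  field
    recurrence : ∀ z → G (ℤ.suc (ℤ.suc z)) ≡ G (ℤ.suc z) ℤ.+ G z

open IsFibonacciLike

F-recurrence : ∀ z → F (ℤ.suc (ℤ.suc z)) ≡ F (ℤ.suc z) ℤ.+ F z
F-recurrence (+ n) = refl
F-recurrence -[1+ 0 ] = refl
F-recurrence -[1+ 1 ] = refl
F-recurrence -[1+ suc (suc n) ] = begin
  σ₂ ℤ.* + a                              ≡⟨ alternate (negOnePow n) (+ a) (+ b) ⟩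
  σ₃ ℤ.* + b ℤ.+ σ₄ ℤ.* (+ b ℤ.+ + a)     ≡⟨ cong (λ w → σ₃ ℤ.* + b ℤ.+ σ₄ ℤ.* w) (ℤP.pos-+ b a) ⟨
  σ₃ ℤ.* + b ℤ.+ σ₄ ℤ.* + (b ℕ.+ a)       ∎
  where
  open ≡-Reasoning
  a = fibℕ (suc n)
  b = fibℕ (suc (suc n))
  σ₂ = negOnePow (suc (suc n))
  σ₃ = negOnePow (suc (suc (suc n)))
  σ₄ = negOnePow (suc (suc (suc (suc n))))
  alternate : ∀ σ a b → (ℤ.- ℤ.- σ) ℤ.* a ≡ (ℤ.- ℤ.- ℤ.- σ) ℤ.* b ℤ.+ (ℤ.- ℤ.- ℤ.- ℤ.- σ) ℤ.* (b ℤ.+ a)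
  alternate = ℤS.solve-∀

F-fibonacciLike : IsFibonacciLike F
F-fibonacciLike = fibonacciLike F-recurrence

module _ {G H : ℤ → ℤ} (fibG : IsFibonacciLike G) (fibH : IsFibonacciLike H) where

  fibonacciLike-+ : IsFibonacciLike (λ z → G z ℤ.+ H z)
  recurrence fibonacciLike-+ z rewrite recurrence fibG z | recurrence fibH z = swap (G (ℤ.suc z)) (G z) (H (ℤ.suc z)) (H z)
    where
    swap : ∀ a b c d → a ℤ.+ b ℤ.+ (c ℤ.+ d) ≡ a ℤ.+ c ℤ.+ (b ℤ.+ d)
    swap = ℤS.solve-∀

  fibonacciLike-- : IsFibonacciLike (λ z → G z ℤ.- H z)
  recurrence fibonacciLike-- z rewrite recurrence fibG z | recurrence fibH z = swap (G (ℤ.suc z)) (G z) (H (ℤ.suc z)) (H z)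
    where
    swap : ∀ a b c d → a ℤ.+ b ℤ.- (c ℤ.+ d) ≡ a ℤ.- c ℤ.+ (b ℤ.- d)
    swap = ℤS.solve-∀

  fibonacciLike-unique₀ : G (+ 0) ≡ H (+ 0) → G (+ 1) ≡ H (+ 1) → ∀ z → G z ≡ H z
  fibonacciLike-unique₀ G0≡H0 G1≡H1 (+ n) = proj₁ (forward n)
    where
    forward : ∀ n → G (+ n) ≡ H (+ n) × G (+ suc n) ≡ H (+ suc n)
    forward zero = G0≡H0 , G1≡H1
    forward (suc n) with forward n
    ... | Gn≡Hn , Gsn≡Hsn = Gsn≡Hsn , trans (recurrence fibG (+ n)) (trans (cong₂ ℤ._+_ Gsn≡Hsn Gn≡Hn) (sym (recurrence fibH (+ n))))
  fibonacciLike-unique₀ G0≡H0 G1≡H1 -[1+ n ] = proj₁ (backward n)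
    where
    previous : ∀ {K} → IsFibonacciLike K → ∀ z → K z ≡ K (ℤ.suc (ℤ.suc z)) ℤ.- K (ℤ.suc z)
    previous {K} fibK z = sym (trans (cong (ℤ._- K (ℤ.suc z)) (recurrence fibK z)) (cancel (K (ℤ.suc z)) (K z)))
      where
      cancel : ∀ a b → a ℤ.+ b ℤ.- a ≡ b
      cancel = ℤS.solve-∀
    backward : ∀ n → G -[1+ n ] ≡ H -[1+ n ] × G (ℤ.suc -[1+ n ]) ≡ H (ℤ.suc -[1+ n ])
    backward zero = trans (previous fibG -[1+ 0 ]) (trans (cong₂ ℤ._-_ G1≡H1 G0≡H0) (sym (previous fibH -[1+ 0 ]))) , G0≡H0
    backward (suc n) with backward n
    ... | Gn≡Hn , Gsn≡Hsn =
      trans (previous fibG -[1+ suc n ]) (trans (cong₂ ℤ._-_ Gsn≡Hsn Gn≡Hn) (sym (previous fibH -[1+ suc n ]))) , Gn≡Hn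

fibonacciLike-* : ∀ {G} c → IsFibonacciLike G → IsFibonacciLike (λ z → c ℤ.* G z)
recurrence (fibonacciLike-* {G} c fibG) z rewrite recurrence fibG z = ℤP.*-distribˡ-+ c (G (ℤ.suc z)) (G z)

fibonacciLike-suc : ∀ {G} → IsFibonacciLike G → IsFibonacciLike (λ z → G (ℤ.suc z))
recurrence (fibonacciLike-suc fibG) z = recurrence fibG (ℤ.suc z)

fibonacciLike-shift : ∀ {G} a → IsFibonacciLike G → IsFibonacciLike (λ z → G (z ℤ.+ a))
recurrence (fibonacciLike-shift {G} a fibG) z =
  trans (cong G (ℤP.+-assoc (+ 1) (ℤ.suc z) a)) (trans (cong G (cong ℤ.suc (ℤP.+-assoc (+ 1) z a)))
    (trans (recurrence fibG (z ℤ.+ a)) (cong (λ w → G w ℤ.+ G (z ℤ.+ a)) (sym (ℤP.+-assoc (+ 1) z a)))))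

fibonacciLike-unique : ∀ {G H} a → IsFibonacciLike G → IsFibonacciLike H →
                       G a ≡ H a → G (ℤ.suc a) ≡ H (ℤ.suc a) → ∀ z → G z ≡ H z
fibonacciLike-unique {G} {H} a fibG fibH Ga≡Ha Gsa≡Hsa z =
  subst (λ w → G w ≡ H w) (cancel z a)
    (fibonacciLike-unique₀ (fibonacciLike-shift a fibG) (fibonacciLike-shift a fibH)
      (subst (λ w → G w ≡ H w) (sym (ℤP.+-identityˡ a)) Ga≡Ha)
      Gsa≡Hsa
      (z ℤ.- a))
  where
  cancel : ∀ z a → z ℤ.- a ℤ.+ a ≡ z
  cancel = ℤS.solve-∀

-- The Lucas numbers L_z = F_{z-1} + F_{z+1}, written without F_{z-1}.
lucas : ℤ → ℤ
lucas z = + 2 ℤ.* F (ℤ.suc z) ℤ.- F z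

lucas-fibonacciLike : IsFibonacciLike lucas
lucas-fibonacciLike = fibonacciLike--
  (fibonacciLike-* (+ 2) (fibonacciLike-suc F-fibonacciLike)) F-fibonacciLike

cassini : ∀ n → F (+ suc n) ℤ.* F (+ suc n) ℤ.- F (+ suc n) ℤ.* F (+ n) ℤ.- F (+ n) ℤ.* F (+ n) ≡ negOnePow n
cassini zero = refl
cassini (suc n) = trans (step (F (+ suc n)) (F (+ n))) (cong ℤ.-_ (cassini n))
  where
  step : ∀ a b → (a ℤ.+ b) ℤ.* (a ℤ.+ b) ℤ.- (a ℤ.+ b) ℤ.* a ℤ.- a ℤ.* a ≡ ℤ.- (a ℤ.* a ℤ.- a ℤ.* b ℤ.- b ℤ.* b)
  step = ℤS.solve-∀

lucas² : ∀ n → lucas (+ n) ℤ.* lucas (+ n) ≡ + 5 ℤ.* (F (+ n) ℤ.* F (+ n)) ℤ.+ + 4 ℤ.* negOnePow n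
lucas² n = trans (expand (F (+ suc n)) (F (+ n))) (cong (λ σ → + 5 ℤ.* (F (+ n) ℤ.* F (+ n)) ℤ.+ + 4 ℤ.* σ) (cassini n))
  where
  expand : ∀ a b → (+ 2 ℤ.* a ℤ.- b) ℤ.* (+ 2 ℤ.* a ℤ.- b) ≡ + 5 ℤ.* (b ℤ.* b) ℤ.+ + 4 ℤ.* (a ℤ.* a ℤ.- a ℤ.* b ℤ.- b ℤ.* b)
  expand = ℤS.solve-∀

suc[z]-z≡1 : ∀ z → ℤ.suc z ℤ.- z ≡ + 1
suc[z]-z≡1 = cancel
  where
  cancel : ∀ z → + 1 ℤ.+ z ℤ.- z ≡ + 1
  cancel = ℤS.solve-∀

dOcagne : ∀ x y → lucas (+ x) ℤ.* F y ℤ.- F (+ x) ℤ.* lucas y ≡ + 2 ℤ.* (negOnePow x ℤ.* F (y ℤ.- + x))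
dOcagne x = fibonacciLike-unique (+ x)
  (fibonacciLike-- (fibonacciLike-* (lucas (+ x)) F-fibonacciLike) (fibonacciLike-* (F (+ x)) lucas-fibonacciLike))
  (fibonacciLike-* (+ 2) (fibonacciLike-* (negOnePow x) (fibonacciLike-shift (ℤ.- + x) F-fibonacciLike)))
  (trans (vanish (lucas (+ x)) (F (+ x)) (negOnePow x))
         (cong (λ w → + 2 ℤ.* (negOnePow x ℤ.* F w)) (sym (ℤP.+-inverseʳ (+ x)))))
  (begin
    lucas (+ x) ℤ.* F (+ suc x) ℤ.- F (+ x) ℤ.* lucas (+ suc x)
      ≡⟨ expand (F (+ suc x)) (F (+ x)) ⟩
    + 2 ℤ.* ((F (+ suc x) ℤ.* F (+ suc x) ℤ.- F (+ suc x) ℤ.* F (+ x) ℤ.- F (+ x) ℤ.* F (+ x)) ℤ.* + 1)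
      ≡⟨ cong₂ (λ σ w → + 2 ℤ.* (σ ℤ.* F w)) (cassini x) (sym (suc[z]-z≡1 (+ x))) ⟩
    + 2 ℤ.* (negOnePow x ℤ.* F (+ suc x ℤ.- + x)) ∎)
  where
  open ≡-Reasoning
  vanish : ∀ l f σ → l ℤ.* f ℤ.- f ℤ.* l ≡ + 2 ℤ.* (σ ℤ.* + 0)
  vanish = ℤS.solve-∀
  expand : ∀ a b → (+ 2 ℤ.* a ℤ.- b) ℤ.* a ℤ.- b ℤ.* (+ 2 ℤ.* (a ℤ.+ b) ℤ.- a)
                   ≡ + 2 ℤ.* ((a ℤ.* a ℤ.- a ℤ.* b ℤ.- b ℤ.* b) ℤ.* + 1)
  expand = ℤS.solve-∀

fib-addition : ∀ t z → + 2 ℤ.* F (z ℤ.+ t) ≡ lucas t ℤ.* F z ℤ.+ F t ℤ.* lucas z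
fib-addition t = fibonacciLike-unique (+ 0)
  (fibonacciLike-* (+ 2) (fibonacciLike-shift t F-fibonacciLike))
  (fibonacciLike-+ (fibonacciLike-* (lucas t) F-fibonacciLike) (fibonacciLike-* (F t) lucas-fibonacciLike))
  (trans (cong (λ w → + 2 ℤ.* F w) (ℤP.+-identityˡ t)) (at-0 (F t) (lucas t)))
  (at-1 (F (ℤ.suc t)) (F t))
  where
  at-0 : ∀ f l → + 2 ℤ.* f ≡ l ℤ.* + 0 ℤ.+ f ℤ.* + 2
  at-0 = ℤS.solve-∀
  at-1 : ∀ a b → + 2 ℤ.* a ≡ (+ 2 ℤ.* a ℤ.- b) ℤ.* + 1 ℤ.+ b ℤ.* + 1
  at-1 = ℤS.solve-∀

negOnePow-±1 : ∀ n → negOnePow n ≡ + 1 ⊎ negOnePow n ≡ -[1+ 0 ]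
negOnePow-±1 zero = inj₁ refl
negOnePow-±1 (suc n) with negOnePow-±1 n
... | inj₁ σ≡1 = inj₂ (cong ℤ.-_ σ≡1)
... | inj₂ σ≡-1 = inj₁ (cong ℤ.-_ σ≡-1)

negOnePow-even : ∀ p → negOnePow (p + p) ≡ + 1
negOnePow-even zero = refl
negOnePow-even (suc p) = begin
  ℤ.- negOnePow (p + suc p)   ≡⟨ cong (λ w → ℤ.- negOnePow w) (ℕP.+-suc p p) ⟩
  ℤ.- ℤ.- negOnePow (p + p)   ≡⟨ ℤP.neg-involutive (negOnePow (p + p)) ⟩
  negOnePow (p + p)           ≡⟨ negOnePow-even p ⟩
  + 1                         ∎
  where open ≡-Reasoning

negOnePow≢0 : ∀ n → negOnePow n ≢ + 0
negOnePow≢0 zero ()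
negOnePow≢0 (suc n) σ≡0 = negOnePow≢0 n (trans (sym (ℤP.neg-involutive (negOnePow n))) (cong ℤ.-_ σ≡0))

fibℕ-pos : ∀ n → 1 ≤ fibℕ (suc n)
fibℕ-pos zero = s≤s z≤n
fibℕ-pos (suc n) = ℕP.≤-trans (fibℕ-pos n) (ℕP.m≤m+n (fibℕ (suc n)) (fibℕ n))

fibℕ-step : ∀ n → fibℕ n ≤ fibℕ (suc n)
fibℕ-step zero = z≤n
fibℕ-step (suc n) = ℕP.m≤m+n (fibℕ (suc n)) (fibℕ n)

fibℕ-mono-≤ : ∀ {m} n → m ≤ n → fibℕ m ≤ fibℕ n
fibℕ-mono-≤ zero z≤n = ℕP.≤-refl
fibℕ-mono-≤ (suc n) m≤1+n with ℕP.m≤n⇒m<n∨m≡n m≤1+n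
... | inj₁ m<1+n = ℕP.≤-trans (fibℕ-mono-≤ n (ℕP.≤-pred m<1+n)) (fibℕ-step n)
... | inj₂ refl = ℕP.≤-refl

n≤1+fibℕ : ∀ n → n ≤ suc (fibℕ n)
n≤1+fibℕ zero = z≤n
n≤1+fibℕ (suc zero) = s≤s z≤n
n≤1+fibℕ (suc (suc zero)) = s≤s (s≤s z≤n)
n≤1+fibℕ (suc (suc (suc n))) = s≤s (ℕP.≤-trans (n≤1+fibℕ (suc (suc n)))
  (subst (_≤ fibℕ (suc (suc (suc n)))) (ℕP.+-comm (fibℕ (suc (suc n))) 1) (ℕP.+-monoʳ-≤ (fibℕ (suc (suc n))) (fibℕ-pos n))))

1≤fibℕ : ∀ {n} → 1 ≤ n → 1 ≤ fibℕ n
1≤fibℕ {suc n} _ = fibℕ-pos n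

F+≢0 : ∀ {n} → 1 ≤ n → F (+ n) ≢ + 0
F+≢0 {suc n} _ Fn≡0 = ℤP.<⇒≢ (ℤ.+<+ (fibℕ-pos n)) (sym Fn≡0)

F≢0 : ∀ {z} → z ≢ + 0 → F z ≢ + 0
F≢0 {+ zero} z≢0 = ⊥-elim (z≢0 refl)
F≢0 {+ suc n} _ = F+≢0 {suc n} (s≤s z≤n)
F≢0 { -[1+ n ]} _ = *-≢0 (negOnePow≢0 (suc (suc n))) (F+≢0 {suc n} (s≤s z≤n))

lucasℕ : ℕ → ℕ
lucasℕ zero = 2
lucasℕ (suc n) = fibℕ (suc n) ℕ.+ 2 ℕ.* fibℕ n

lucas-+ : ∀ n → lucas (+ n) ≡ + lucasℕ n
lucas-+ zero = refl
lucas-+ (suc n) = begin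
  + 2 ℤ.* + (a ℕ.+ b) ℤ.- + a     ≡⟨ cong (λ w → + 2 ℤ.* w ℤ.- + a) (ℤP.pos-+ a b) ⟩
  + 2 ℤ.* (+ a ℤ.+ + b) ℤ.- + a   ≡⟨ simplify (+ a) (+ b) ⟩
  + a ℤ.+ + 2 ℤ.* + b             ≡⟨ cong (λ w → + a ℤ.+ w) (ℤP.pos-* 2 b) ⟨
  + a ℤ.+ + (2 ℕ.* b)             ≡⟨ ℤP.pos-+ a (2 ℕ.* b) ⟨
  + lucasℕ (suc n)                ∎
  where
  open ≡-Reasoning
  a = fibℕ (suc n)
  b = fibℕ n
  simplify : ∀ a b → + 2 ℤ.* (a ℤ.+ b) ℤ.- a ≡ a ℤ.+ + 2 ℤ.* b
  simplify = ℤS.solve-∀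

lucasℕ² : ∀ n → + (lucasℕ n ℕ.* lucasℕ n) ≡ + (5 ℕ.* (fibℕ n ℕ.* fibℕ n)) ℤ.+ + 4 ℤ.* negOnePow n
lucasℕ² n = begin
  + (lucasℕ n ℕ.* lucasℕ n)                                   ≡⟨ ℤP.pos-* (lucasℕ n) (lucasℕ n) ⟩
  + lucasℕ n ℤ.* + lucasℕ n                                   ≡⟨ cong₂ ℤ._*_ (lucas-+ n) (lucas-+ n) ⟨
  lucas (+ n) ℤ.* lucas (+ n)                                 ≡⟨ lucas² n ⟩
  + 5 ℤ.* (+ fibℕ n ℤ.* + fibℕ n) ℤ.+ + 4 ℤ.* negOnePow n     ≡⟨ cong (λ w → + 5 ℤ.* w ℤ.+ + 4 ℤ.* negOnePow n) (ℤP.pos-* (fibℕ n) (fibℕ n)) ⟨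
  + 5 ℤ.* + (fibℕ n ℕ.* fibℕ n) ℤ.+ + 4 ℤ.* negOnePow n       ≡⟨ cong (ℤ._+ + 4 ℤ.* negOnePow n) (ℤP.pos-* 5 (fibℕ n ℕ.* fibℕ n)) ⟨
  + (5 ℕ.* (fibℕ n ℕ.* fibℕ n)) ℤ.+ + 4 ℤ.* negOnePow n       ∎
  where open ≡-Reasoning

lucasℕ²-even : ∀ n → negOnePow n ≡ + 1 → lucasℕ n ℕ.* lucasℕ n ≡ 5 ℕ.* (fibℕ n ℕ.* fibℕ n) ℕ.+ 4
lucasℕ²-even n σ≡1 =
  ℤP.+-injective (subst (λ σ → + (lucasℕ n ℕ.* lucasℕ n) ≡ + (5 ℕ.* (fibℕ n ℕ.* fibℕ n)) ℤ.+ + 4 ℤ.* σ) σ≡1 (lucasℕ² n))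

lucasℕ²-odd : ∀ n → negOnePow n ≡ -[1+ 0 ] → lucasℕ n ℕ.* lucasℕ n ℕ.+ 4 ≡ 5 ℕ.* (fibℕ n ℕ.* fibℕ n)
lucasℕ²-odd n σ≡-1 = ℤP.+-injective (begin
  + (L² ℕ.+ 4)            ≡⟨ cong (ℤ._+ + 4) (subst (λ σ → + L² ≡ + 5F² ℤ.+ + 4 ℤ.* σ) σ≡-1 (lucasℕ² n)) ⟩
  + 5F² ℤ.+ -[1+ 3 ] ℤ.+ + 4 ≡⟨ cancel (+ 5F²) ⟩
  + 5F²                   ∎)
  where
  open ≡-Reasoning
  L² = lucasℕ n ℕ.* lucasℕ n
  5F² = 5 ℕ.* (fibℕ n ℕ.* fibℕ n)
  cancel : ∀ a → a ℤ.+ -[1+ 3 ] ℤ.+ + 4 ≡ a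
  cancel = ℤS.solve-∀

lucasℕ²≤ : ∀ n → lucasℕ n ℕ.* lucasℕ n ≤ 5 ℕ.* (fibℕ n ℕ.* fibℕ n) ℕ.+ 4
lucasℕ²≤ n with negOnePow-±1 n
... | inj₁ σ≡1 = ℕP.≤-reflexive (lucasℕ²-even n σ≡1)
... | inj₂ σ≡-1 = ℕP.≤-trans (ℕP.m≤m+n _ 4) (ℕP.≤-trans (ℕP.≤-reflexive (lucasℕ²-odd n σ≡-1)) (ℕP.m≤m+n _ 4))

5fibℕ²≤ : ∀ n → 5 ℕ.* (fibℕ n ℕ.* fibℕ n) ≤ lucasℕ n ℕ.* lucasℕ n ℕ.+ 4
5fibℕ²≤ n with negOnePow-±1 n
... | inj₁ σ≡1 = ℕP.≤-trans (ℕP.m≤m+n _ 4) (ℕP.≤-trans (ℕP.≤-reflexive (sym (lucasℕ²-even n σ≡1))) (ℕP.m≤m+n _ 4))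
... | inj₂ σ≡-1 = ℕP.≤-reflexive (sym (lucasℕ²-odd n σ≡-1))

m*m≤n*n⇒m≤n : ∀ {m n} → m ℕ.* m ≤ n ℕ.* n → m ≤ n
m*m≤n*n⇒m≤n m²≤n² = ℕP.≮⇒≥ λ n<m → ℕP.<⇒≱ (ℕP.*-mono-< n<m n<m) m²≤n²

-- Fed with L_n² − 5F_n² = ±4, these compare the ratios a/b and c/d of two Lucas–Fibonacci pairs.
pell+4⇒cross-≤ : ∀ a b c d → a ℕ.* a ≤ 5 ℕ.* (b ℕ.* b) ℕ.+ 4 → c ℕ.* c ≡ 5 ℕ.* (d ℕ.* d) ℕ.+ 4 →
                 d ≤ b → a ℕ.* d ≤ c ℕ.* b
pell+4⇒cross-≤ a b c d a²≤ c²≡ d≤b = m*m≤n*n⇒m≤n (begin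
  a ℕ.* d ℕ.* (a ℕ.* d)                                 ≡⟨ e₁ a d ⟩
  a ℕ.* a ℕ.* (d ℕ.* d)                                 ≤⟨ ℕP.*-monoˡ-≤ (d ℕ.* d) a²≤ ⟩
  (5 ℕ.* (b ℕ.* b) ℕ.+ 4) ℕ.* (d ℕ.* d)                 ≡⟨ e₂ b d ⟩
  5 ℕ.* (d ℕ.* d) ℕ.* (b ℕ.* b) ℕ.+ 4 ℕ.* (d ℕ.* d)     ≤⟨ ℕP.+-monoʳ-≤ (5 ℕ.* (d ℕ.* d) ℕ.* (b ℕ.* b)) (ℕP.*-monoʳ-≤ 4 (ℕP.*-mono-≤ d≤b d≤b)) ⟩
  5 ℕ.* (d ℕ.* d) ℕ.* (b ℕ.* b) ℕ.+ 4 ℕ.* (b ℕ.* b)     ≡⟨ e₃ d b ⟩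
  (5 ℕ.* (d ℕ.* d) ℕ.+ 4) ℕ.* (b ℕ.* b)                 ≡⟨ cong (ℕ._* (b ℕ.* b)) c²≡ ⟨
  c ℕ.* c ℕ.* (b ℕ.* b)                                 ≡⟨ e₁ c b ⟨
  c ℕ.* b ℕ.* (c ℕ.* b)                                 ∎)
  where
  open ℕP.≤-Reasoning
  e₁ : ∀ x y → x ℕ.* y ℕ.* (x ℕ.* y) ≡ x ℕ.* x ℕ.* (y ℕ.* y)
  e₁ = ℕS.solve-∀
  e₂ : ∀ b d → (5 ℕ.* (b ℕ.* b) ℕ.+ 4) ℕ.* (d ℕ.* d) ≡ 5 ℕ.* (d ℕ.* d) ℕ.* (b ℕ.* b) ℕ.+ 4 ℕ.* (d ℕ.* d)
  e₂ = ℕS.solve-∀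
  e₃ : ∀ d b → 5 ℕ.* (d ℕ.* d) ℕ.* (b ℕ.* b) ℕ.+ 4 ℕ.* (b ℕ.* b) ≡ (5 ℕ.* (d ℕ.* d) ℕ.+ 4) ℕ.* (b ℕ.* b)
  e₃ = ℕS.solve-∀

pell-4⇒cross-≤ : ∀ a b c d → 5 ℕ.* (b ℕ.* b) ≤ a ℕ.* a ℕ.+ 4 → c ℕ.* c ℕ.+ 4 ≡ 5 ℕ.* (d ℕ.* d) →
                 d ≤ b → c ℕ.* b ≤ a ℕ.* d
pell-4⇒cross-≤ a b c d 5b²≤ c²≡ d≤b = m*m≤n*n⇒m≤n (ℕP.+-cancelʳ-≤ (4 ℕ.* (b ℕ.* b)) _ _ (begin
  c ℕ.* b ℕ.* (c ℕ.* b) ℕ.+ 4 ℕ.* (b ℕ.* b)             ≡⟨ e₁ c b ⟩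
  (c ℕ.* c ℕ.+ 4) ℕ.* (b ℕ.* b)                         ≡⟨ cong (ℕ._* (b ℕ.* b)) c²≡ ⟩
  5 ℕ.* (d ℕ.* d) ℕ.* (b ℕ.* b)                         ≡⟨ e₂ d b ⟩
  5 ℕ.* (b ℕ.* b) ℕ.* (d ℕ.* d)                         ≤⟨ ℕP.*-monoˡ-≤ (d ℕ.* d) 5b²≤ ⟩
  (a ℕ.* a ℕ.+ 4) ℕ.* (d ℕ.* d)                         ≡⟨ e₁ a d ⟨
  a ℕ.* d ℕ.* (a ℕ.* d) ℕ.+ 4 ℕ.* (d ℕ.* d)             ≤⟨ ℕP.+-monoʳ-≤ (a ℕ.* d ℕ.* (a ℕ.* d)) (ℕP.*-monoʳ-≤ 4 (ℕP.*-mono-≤ d≤b d≤b)) ⟩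
  a ℕ.* d ℕ.* (a ℕ.* d) ℕ.+ 4 ℕ.* (b ℕ.* b)             ∎))
  where
  open ℕP.≤-Reasoning
  e₁ : ∀ x y → x ℕ.* y ℕ.* (x ℕ.* y) ℕ.+ 4 ℕ.* (y ℕ.* y) ≡ (x ℕ.* x ℕ.+ 4) ℕ.* (y ℕ.* y)
  e₁ = ℕS.solve-∀
  e₂ : ∀ d b → 5 ℕ.* (d ℕ.* d) ℕ.* (b ℕ.* b) ≡ 5 ℕ.* (b ℕ.* b) ℕ.* (d ℕ.* d)
  e₂ = ℕS.solve-∀

lucas/fib : ℕ → ℚ
lucas/fib n = divℤ (lucas (+ n)) (F (+ n))

fib-quotient-telescopes : ∀ {x y} → 1 ≤ x → 1 ≤ y →
  divℤ (negOnePow x ℤ.* F (+ y ℤ.- + x)) (F (+ x) ℤ.* F (+ y)) ≡ ½ ℚ.* (lucas/fib x ℚ.- lucas/fib y)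
fib-quotient-telescopes {x} {y} 1≤x 1≤y = divℤ-unique (*-≢0 (F+≢0 1≤x) (F+≢0 1≤y)) (begin
  ½ ℚ.* (rx ℚ.- ry) ℚ.* fromℤ (Fx ℤ.* Fy)                   ≡⟨ cong (½ ℚ.* (rx ℚ.- ry) ℚ.*_) (fromℤ-homo-* Fx Fy) ⟩
  ½ ℚ.* (rx ℚ.- ry) ℚ.* (fromℤ Fx ℚ.* fromℤ Fy)             ≡⟨ distrib rx ry (fromℤ Fx) (fromℤ Fy) ⟩
  ½ ℚ.* (rx ℚ.* fromℤ Fx ℚ.* fromℤ Fy ℚ.- fromℤ Fx ℚ.* (ry ℚ.* fromℤ Fy))
                                                           ≡⟨ cong₂ (λ p q → ½ ℚ.* (p ℚ.* fromℤ Fy ℚ.- fromℤ Fx ℚ.* q))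
                                                                    (divℤ-*ʳ (lucas (+ x)) (F+≢0 1≤x)) (divℤ-*ʳ (lucas (+ y)) (F+≢0 1≤y)) ⟩
  ½ ℚ.* (fromℤ Lx ℚ.* fromℤ Fy ℚ.- fromℤ Fx ℚ.* fromℤ Ly)   ≡⟨ cong (½ ℚ.*_) (sym (fromℤ-homo-cross Lx Fy Fx Ly)) ⟩
  ½ ℚ.* fromℤ (Lx ℤ.* Fy ℤ.- Fx ℤ.* Ly)                     ≡⟨ cong (λ w → ½ ℚ.* fromℤ w) (dOcagne x (+ y)) ⟩
  ½ ℚ.* fromℤ (+ 2 ℤ.* (negOnePow x ℤ.* F (+ y ℤ.- + x)))   ≡⟨ ½*fromℤ-double (negOnePow x ℤ.* F (+ y ℤ.- + x)) ⟩
  fromℤ (negOnePow x ℤ.* F (+ y ℤ.- + x))                  ∎)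
  where
  open ≡-Reasoning
  rx = lucas/fib x
  ry = lucas/fib y
  Fx = F (+ x)
  Fy = F (+ y)
  Lx = lucas (+ x)
  Ly = lucas (+ y)
  distrib : ∀ p q a b → ½ ℚ.* (p ℚ.- q) ℚ.* (a ℚ.* b) ≡ ½ ℚ.* (p ℚ.* a ℚ.* b ℚ.- a ℚ.* (q ℚ.* b))
  distrib = solve-∀ ℚ-ring
  fromℤ-homo-cross : ∀ a b c d → fromℤ (a ℤ.* b ℤ.- c ℤ.* d) ≡ fromℤ a ℚ.* fromℤ b ℚ.- fromℤ c ℚ.* fromℤ d
  fromℤ-homo-cross a b c d =
    trans (fromℤ-homo-- (a ℤ.* b) (c ℤ.* d)) (cong₂ ℚ._-_ (fromℤ-homo-* a b) (fromℤ-homo-* c d))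

fib-shift-quotient : ∀ t {x} → 1 ≤ x →
  divℤ (F (+ x ℤ.+ t)) (F (+ x)) ≡ ½ ℚ.* fromℤ (lucas t) ℚ.+ ½ ℚ.* fromℤ (F t) ℚ.* lucas/fib x
fib-shift-quotient t {x} 1≤x = divℤ-unique (F+≢0 1≤x) (begin
  (½ ℚ.* fromℤ Lt ℚ.+ ½ ℚ.* fromℤ Ft ℚ.* rx) ℚ.* fromℤ Fx   ≡⟨ distrib (fromℤ Lt) (fromℤ Ft) rx (fromℤ Fx) ⟩
  ½ ℚ.* (fromℤ Lt ℚ.* fromℤ Fx ℚ.+ fromℤ Ft ℚ.* (rx ℚ.* fromℤ Fx))
                                                          ≡⟨ cong (λ q → ½ ℚ.* (fromℤ Lt ℚ.* fromℤ Fx ℚ.+ fromℤ Ft ℚ.* q))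
                                                                  (divℤ-*ʳ (lucas (+ x)) (F+≢0 1≤x)) ⟩
  ½ ℚ.* (fromℤ Lt ℚ.* fromℤ Fx ℚ.+ fromℤ Ft ℚ.* fromℤ Lx)  ≡⟨ cong (½ ℚ.*_) (sym (fromℤ-homo-lin Lt Fx Ft Lx)) ⟩
  ½ ℚ.* fromℤ (Lt ℤ.* Fx ℤ.+ Ft ℤ.* Lx)                    ≡⟨ cong (λ w → ½ ℚ.* fromℤ w) (fib-addition t (+ x)) ⟨
  ½ ℚ.* fromℤ (+ 2 ℤ.* F (+ x ℤ.+ t))                      ≡⟨ ½*fromℤ-double (F (+ x ℤ.+ t)) ⟩
  fromℤ (F (+ x ℤ.+ t))                                   ∎)
  where
  open ≡-Reasoning
  rx = lucas/fib x
  Fx = F (+ x)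
  Lx = lucas (+ x)
  Ft = F t
  Lt = lucas t
  distrib : ∀ l f r a → (½ ℚ.* l ℚ.+ ½ ℚ.* f ℚ.* r) ℚ.* a ≡ ½ ℚ.* (l ℚ.* a ℚ.+ f ℚ.* (r ℚ.* a))
  distrib = solve-∀ ℚ-ring
  fromℤ-homo-lin : ∀ a b c d → fromℤ (a ℤ.* b ℤ.+ c ℤ.* d) ≡ fromℤ a ℚ.* fromℤ b ℚ.+ fromℤ c ℚ.* fromℤ d
  fromℤ-homo-lin a b c d =
    trans (fromℤ-homo-+ (a ℤ.* b) (c ℤ.* d)) (cong₂ ℚ._+_ (fromℤ-homo-* a b) (fromℤ-homo-* c d))

lucas/fib-ℕ : ∀ n → lucas/fib n ≡ divℤ (+ lucasℕ n) (+ fibℕ n)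
lucas/fib-ℕ n = cong (λ l → divℤ l (F (+ n))) (lucas-+ n)

lucas/fib-nonNeg : ∀ {n} → 1 ≤ n → 0ℚ ℚ.≤ lucas/fib n
lucas/fib-nonNeg {n} 1≤n rewrite lucas/fib-ℕ n = divℕ-mono-≤ 0 1 (lucasℕ n) (fibℕ n) (s≤s z≤n) (1≤fibℕ 1≤n) z≤n

lucas/fib² : ∀ {n} → 1 ≤ n →
  lucas/fib n ℚ.* lucas/fib n ≡ divℤ (+ (lucasℕ n ℕ.* lucasℕ n)) (+ (fibℕ n ℕ.* fibℕ n))
lucas/fib² {n} 1≤n rewrite lucas/fib-ℕ n =
  trans (divℤ-* (+ lucasℕ n) (+ lucasℕ n) (F+≢0 1≤n) (F+≢0 1≤n))
        (sym (cong₂ divℤ (ℤP.pos-* (lucasℕ n) (lucasℕ n)) (ℤP.pos-* (fibℕ n) (fibℕ n))))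

lucas/fib-odd-≤√5 : ∀ {o} → 1 ≤ o → negOnePow o ≡ -[1+ 0 ] → lucas/fib o ≤√5
lucas/fib-odd-≤√5 {o} 1≤o σ≡-1 = lucas/fib-nonNeg 1≤o , subst (ℚ._≤ fromℤ (+ 5)) (sym (lucas/fib² 1≤o))
  (divℕ-mono-≤ (lucasℕ o ℕ.* lucasℕ o) (fibℕ o ℕ.* fibℕ o) 5 1 (ℕP.*-mono-≤ (1≤fibℕ 1≤o) (1≤fibℕ 1≤o)) (s≤s z≤n)
    (ℕP.≤-trans (ℕP.≤-reflexive (ℕP.*-identityʳ _)) (ℕP.≤-trans (ℕP.m≤m+n _ 4) (ℕP.≤-reflexive (lucasℕ²-odd o σ≡-1)))))

lucas/fib-even-√5≤ : ∀ {e} → 1 ≤ e → negOnePow e ≡ + 1 → √5≤ lucas/fib e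
lucas/fib-even-√5≤ {e} 1≤e σ≡1 = lucas/fib-nonNeg 1≤e , subst (fromℤ (+ 5) ℚ.≤_) (sym (lucas/fib² 1≤e))
  (divℕ-mono-≤ 5 1 (lucasℕ e ℕ.* lucasℕ e) (fibℕ e ℕ.* fibℕ e) (s≤s z≤n) (ℕP.*-mono-≤ (1≤fibℕ 1≤e) (1≤fibℕ 1≤e))
    (ℕP.≤-trans (ℕP.m≤m+n _ 4) (ℕP.≤-trans (ℕP.≤-reflexive (sym (lucasℕ²-even e σ≡1))) (ℕP.≤-reflexive (sym (ℕP.*-identityʳ _))))))

lucas/fib-≤-even : ∀ {x e} → 1 ≤ x → 1 ≤ e → negOnePow e ≡ + 1 → fibℕ e ≤ fibℕ x → lucas/fib x ℚ.≤ lucas/fib e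
lucas/fib-≤-even {x} {e} 1≤x 1≤e σ≡1 Fe≤Fx rewrite lucas/fib-ℕ x | lucas/fib-ℕ e =
  divℕ-mono-≤ (lucasℕ x) (fibℕ x) (lucasℕ e) (fibℕ e) (1≤fibℕ 1≤x) (1≤fibℕ 1≤e)
    (pell+4⇒cross-≤ (lucasℕ x) (fibℕ x) (lucasℕ e) (fibℕ e) (lucasℕ²≤ x) (lucasℕ²-even e σ≡1) Fe≤Fx)

lucas/fib-≥-odd : ∀ {x o} → 1 ≤ x → 1 ≤ o → negOnePow o ≡ -[1+ 0 ] → fibℕ o ≤ fibℕ x → lucas/fib o ℚ.≤ lucas/fib x
lucas/fib-≥-odd {x} {o} 1≤x 1≤o σ≡-1 Fo≤Fx rewrite lucas/fib-ℕ x | lucas/fib-ℕ o =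
  divℕ-mono-≤ (lucasℕ o) (fibℕ o) (lucasℕ x) (fibℕ x) (1≤fibℕ 1≤o) (1≤fibℕ 1≤x)
    (pell-4⇒cross-≤ (lucasℕ x) (fibℕ x) (lucasℕ o) (fibℕ o) (5fibℕ²≤ x) (lucasℕ²-odd o σ≡-1) Fo≤Fx)

lucas/fib-between : ∀ p {x} → 1 ≤ p → suc (p + p) ≤ x →
  lucas/fib (suc (p + p)) ℚ.≤ lucas/fib x × lucas/fib x ℚ.≤ lucas/fib (p + p)
lucas/fib-between p {x} 1≤p o≤x =
    lucas/fib-≥-odd {o = suc (p + p)} 1≤x (s≤s z≤n) (cong ℤ.-_ (negOnePow-even p)) (fibℕ-mono-≤ x o≤x)
  , lucas/fib-≤-even 1≤x 1≤e (negOnePow-even p) (fibℕ-mono-≤ x (ℕP.≤-trans (ℕP.n≤1+n (p + p)) o≤x))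
  where
  1≤e : 1 ≤ p + p
  1≤e = ℕP.≤-trans 1≤p (ℕP.m≤m+n p p)
  1≤x : 1 ≤ x
  1≤x = ℕP.≤-trans (s≤s z≤n) o≤x

lucas/fib-gap : ∀ k p → 1 ≤ p →
  ½ ℚ.* fromℤ (+ k) ℚ.* (lucas/fib (p + p) ℚ.- lucas/fib (suc (p + p)))
  ≡ divℤ (+ k) (F (+ (p + p)) ℤ.* F (+ suc (p + p)))
lucas/fib-gap k p 1≤p = begin
  ½ ℚ.* fromℤ (+ k) ℚ.* (rₑ ℚ.- rₒ)                 ≡⟨ reassoc (fromℤ (+ k)) rₑ rₒ ⟩
  fromℤ (+ k) ℚ.* (½ ℚ.* (rₑ ℚ.- rₒ))               ≡⟨ cong (fromℤ (+ k) ℚ.*_) (fib-quotient-telescopes 1≤e (s≤s z≤n)) ⟨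
  fromℤ (+ k) ℚ.* divℤ (negOnePow e ℤ.* F (+ suc e ℤ.- + e)) B
                                                    ≡⟨ cong (λ σ → fromℤ (+ k) ℚ.* divℤ σ B) numerator≡1 ⟩
  fromℤ (+ k) ℚ.* divℤ (+ 1) B                      ≡⟨ fromℤ*divℤ (+ k) (+ 1) (*-≢0 (F+≢0 1≤e) (F+≢0 {suc e} (s≤s z≤n))) ⟩
  divℤ (+ k ℤ.* + 1) B                              ≡⟨ cong (λ a → divℤ a B) (ℤP.*-identityʳ (+ k)) ⟩
  divℤ (+ k) B                                      ∎
  where
  open ≡-Reasoning
  e = p + p
  rₑ = lucas/fib e
  rₒ = lucas/fib (suc e)
  B = F (+ e) ℤ.* F (+ suc e)
  1≤e : 1 ≤ e
  1≤e = ℕP.≤-trans 1≤p (ℕP.m≤m+n p p)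
  numerator≡1 : negOnePow e ℤ.* F (+ suc e ℤ.- + e) ≡ + 1
  numerator≡1 = cong₂ (λ σ z → σ ℤ.* F z) (negOnePow-even p) (suc[z]-z≡1 (+ e))
  reassoc : ∀ K x y → ½ ℚ.* K ℚ.* (x ℚ.- y) ≡ K ℚ.* (½ ℚ.* (x ℚ.- y))
  reassoc = solve-∀ ℚ-ring

-- F_{2p} ≥ p exceeds k times the denominator of ε.
lucas/fib-gap<ε : ∀ {ε} k → 0ℚ ℚ.< ε → let p = suc (k ℕ.* ℚ.↧ₙ ε) in
  ½ ℚ.* fromℤ (+ k) ℚ.* (lucas/fib (p + p) ℚ.- lucas/fib (suc (p + p))) ℚ.< ε
lucas/fib-gap<ε {ε} k 0<ε =
  subst (ℚ._< ε) (sym (trans (lucas/fib-gap k p (s≤s z≤n)) (cong (divℤ (+ k)) (sym (ℤP.pos-* fe fo)))))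
    (divℕ<ε k (fe ℕ.* fo) 0<ε (ℕP.<-≤-trans (ℕP.n<1+n (k ℕ.* ℚ.↧ₙ ε)) p≤fe*fo))
  where
  open ℕP.≤-Reasoning
  p = suc (k ℕ.* ℚ.↧ₙ ε)
  fe = fibℕ (p + p)
  fo = fibℕ (suc (p + p))
  p≤fe*fo : p ≤ fe ℕ.* fo
  p≤fe*fo = begin
    p              ≤⟨ ℕP.m≤n+m p (k ℕ.* ℚ.↧ₙ ε) ⟩
    k ℕ.* ℚ.↧ₙ ε + p ≤⟨ ℕP.≤-pred (n≤1+fibℕ (p + p)) ⟩
    fe             ≡⟨ ℕP.*-identityʳ fe ⟨
    fe ℕ.* 1       ≤⟨ ℕP.*-monoʳ-≤ fe (fibℕ-pos (p + p)) ⟩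
    fe ℕ.* fo      ∎

lucas+fib√5/2 : ℤ → Q5
lucas+fib√5/2 z = (½ ℚ.* fromℤ (lucas z)) +√5· (½ ℚ.* fromℤ (F z))

lucas+fib√5/2-expand : ∀ z → lucas+fib√5/2 z ≡
  (½ ℚ.* (fromℤ (+ 2) ℚ.* fromℤ (F (ℤ.suc z)) ℚ.- fromℤ (F z))) +√5· (½ ℚ.* fromℤ (F z))
lucas+fib√5/2-expand z = cong (λ l → (½ ℚ.* l) +√5· (½ ℚ.* fromℤ (F z)))
  (trans (fromℤ-homo-- (+ 2 ℤ.* F (ℤ.suc z)) (F z)) (cong (ℚ._- fromℤ (F z)) (fromℤ-homo-* (+ 2) (F (ℤ.suc z)))))

fromℤ-F-recurrence : ∀ z → fromℤ (F (ℤ.suc (ℤ.suc z))) ≡ fromℤ (F (ℤ.suc z)) ℚ.+ fromℤ (F z)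
fromℤ-F-recurrence z = trans (cong fromℤ (F-recurrence z)) (fromℤ-homo-+ (F (ℤ.suc z)) (F z))

lucas+fib√5/2-suc : ∀ z → lucas+fib√5/2 (ℤ.suc z) ≡
  (½ ℚ.* (fromℤ (+ 2) ℚ.* (fromℤ (F (ℤ.suc z)) ℚ.+ fromℤ (F z)) ℚ.- fromℤ (F (ℤ.suc z)))) +√5· (½ ℚ.* fromℤ (F (ℤ.suc z)))
lucas+fib√5/2-suc z = trans (lucas+fib√5/2-expand (ℤ.suc z))
  (cong (λ f₂ → (½ ℚ.* (fromℤ (+ 2) ℚ.* f₂ ℚ.- fromℤ (F (ℤ.suc z)))) +√5· (½ ℚ.* fromℤ (F (ℤ.suc z))))
        (fromℤ-F-recurrence z))

Φ⊗lucas+fib√5/2 : ∀ z → Φ ⊗ lucas+fib√5/2 z ≡ lucas+fib√5/2 (ℤ.suc z)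
Φ⊗lucas+fib√5/2 z = begin
  Φ ⊗ lucas+fib√5/2 z  ≡⟨ cong (Φ ⊗_) (lucas+fib√5/2-expand z) ⟩
  Φ ⊗ ((½ ℚ.* (fromℤ (+ 2) ℚ.* f₁ ℚ.- f₀)) +√5· (½ ℚ.* f₀))
                       ≡⟨ cong₂ _+√5·_ (re-step f₁ f₀) (im-step f₁ f₀) ⟩
  (½ ℚ.* (fromℤ (+ 2) ℚ.* (f₁ ℚ.+ f₀) ℚ.- f₁)) +√5· (½ ℚ.* f₁)
                       ≡⟨ lucas+fib√5/2-suc z ⟨
  lucas+fib√5/2 (ℤ.suc z) ∎
  where
  open ≡-Reasoning
  f₀ = fromℤ (F z)
  f₁ = fromℤ (F (ℤ.suc z))
  re-step : ∀ f₁ f₀ → ½ ℚ.* (½ ℚ.* (fromℤ (+ 2) ℚ.* f₁ ℚ.- f₀)) ℚ.+ fromℤ (+ 5) ℚ.* ½ ℚ.* (½ ℚ.* f₀)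
                      ≡ ½ ℚ.* (fromℤ (+ 2) ℚ.* (f₁ ℚ.+ f₀) ℚ.- f₁)
  re-step = solve-∀ ℚ-ring
  im-step : ∀ f₁ f₀ → ½ ℚ.* (½ ℚ.* f₀) ℚ.+ ½ ℚ.* (½ ℚ.* (fromℤ (+ 2) ℚ.* f₁ ℚ.- f₀)) ≡ ½ ℚ.* f₁
  im-step = solve-∀ ℚ-ring

Φ⁻¹⊗lucas+fib√5/2 : ∀ z → inv Φ ⊗ lucas+fib√5/2 (ℤ.suc z) ≡ lucas+fib√5/2 z
Φ⁻¹⊗lucas+fib√5/2 z = begin
  inv Φ ⊗ lucas+fib√5/2 (ℤ.suc z)
      ≡⟨ cong (inv Φ ⊗_) (lucas+fib√5/2-suc z) ⟩
  inv Φ ⊗ ((½ ℚ.* (fromℤ (+ 2) ℚ.* (f₁ ℚ.+ f₀) ℚ.- f₁)) +√5· (½ ℚ.* f₁))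
      ≡⟨ cong₂ _+√5·_ (re-step f₁ f₀) (im-step f₁ f₀) ⟩
  (½ ℚ.* (fromℤ (+ 2) ℚ.* f₁ ℚ.- f₀)) +√5· (½ ℚ.* f₀)
      ≡⟨ lucas+fib√5/2-expand z ⟨
  lucas+fib√5/2 z ∎
  where
  open ≡-Reasoning
  f₀ = fromℤ (F z)
  f₁ = fromℤ (F (ℤ.suc z))
  re-step : ∀ f₁ f₀ → ℚ.- ½ ℚ.* (½ ℚ.* (fromℤ (+ 2) ℚ.* (f₁ ℚ.+ f₀) ℚ.- f₁)) ℚ.+ fromℤ (+ 5) ℚ.* ½ ℚ.* (½ ℚ.* f₁)
                      ≡ ½ ℚ.* (fromℤ (+ 2) ℚ.* f₁ ℚ.- f₀)
  re-step = solve-∀ ℚ-ring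
  im-step : ∀ f₁ f₀ → ℚ.- ½ ℚ.* (½ ℚ.* f₁) ℚ.+ ½ ℚ.* (½ ℚ.* (fromℤ (+ 2) ℚ.* (f₁ ℚ.+ f₀) ℚ.- f₁)) ≡ ½ ℚ.* f₀
  im-step = solve-∀ ℚ-ring

pow-Φ : ∀ t → pow Φ t ≡ lucas+fib√5/2 t
pow-Φ (+ n) = powℕ-Φ n
  where
  powℕ-Φ : ∀ n → powℕ Φ n ≡ lucas+fib√5/2 (+ n)
  powℕ-Φ zero = refl
  powℕ-Φ (suc n) = trans (cong (Φ ⊗_) (powℕ-Φ n)) (Φ⊗lucas+fib√5/2 (+ n))
pow-Φ -[1+ n ] = powℕ-Φ⁻¹ (suc n)
  where
  suc-neg : ∀ n → ℤ.suc -[1+ n ] ≡ ℤ.- + n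
  suc-neg zero = refl
  suc-neg (suc n) = refl
  powℕ-Φ⁻¹ : ∀ n → powℕ (inv Φ) n ≡ lucas+fib√5/2 (ℤ.- + n)
  powℕ-Φ⁻¹ zero = refl
  powℕ-Φ⁻¹ (suc n) = trans (cong (inv Φ ⊗_) (powℕ-Φ⁻¹ n))
    (subst (λ w → inv Φ ⊗ lucas+fib√5/2 w ≡ lucas+fib√5/2 -[1+ n ]) (suc-neg n) (Φ⁻¹⊗lucas+fib√5/2 -[1+ n ]))

series-telescopes : ∀ (u : ℕ → ℕ) k → (∀ n → 1 ≤ n → 1 ≤ u n) → ∀ m →
  sumFrom1 (λ n → divℤ (negOnePow (u n) ℤ.* F (+ u (n + k) ℤ.- + u n)) (F (+ u n) ℤ.* F (+ u (n + k)))) m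
  ≡ ½ ℚ.* (sumFrom1 (λ j → lucas/fib (u j)) k ℚ.- sumFrom1 (λ j → lucas/fib (u (m + j))) k)
series-telescopes u k 1≤u m = begin
  sumFrom1 (λ n → divℤ (negOnePow (u n) ℤ.* F (+ u (n + k) ℤ.- + u n)) (F (+ u n) ℤ.* F (+ u (n + k)))) m
      ≡⟨ sumFrom1-cong m (λ n 1≤n → fib-quotient-telescopes (1≤u n 1≤n) (1≤u (n + k) (ℕP.≤-trans 1≤n (ℕP.m≤m+n n k)))) ⟩
  sumFrom1 (λ n → ½ ℚ.* (c n ℚ.- c (n + k))) m
      ≡⟨ sumFrom1-*ˡ ½ (λ n → c n ℚ.- c (n + k)) m ⟩
  ½ ℚ.* sumFrom1 (λ n → c n ℚ.- c (n + k)) m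
      ≡⟨ cong (½ ℚ.*_) (sumFrom1-telescope c k m) ⟩
  ½ ℚ.* (sumFrom1 c k ℚ.- sumFrom1 (λ j → c (m + j)) k) ∎
  where
  open ≡-Reasoning
  c : ℕ → ℚ
  c j = lucas/fib (u j)

fib-shift-sum : ∀ (u : ℕ → ℕ) t k → (∀ n → 1 ≤ n → 1 ≤ u n) →
  sumFrom1 (λ n → divℤ (F (+ u n ℤ.+ t)) (F (+ u n))) k
  ≡ fromℤ (+ k) ℚ.* (½ ℚ.* fromℤ (lucas t)) ℚ.+ ½ ℚ.* fromℤ (F t) ℚ.* sumFrom1 (λ j → lucas/fib (u j)) k
fib-shift-sum u t k 1≤u = begin
  sumFrom1 (λ n → divℤ (F (+ u n ℤ.+ t)) (F (+ u n))) k
      ≡⟨ sumFrom1-cong k (λ n 1≤n → fib-shift-quotient t (1≤u n 1≤n)) ⟩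
  sumFrom1 (λ n → a ℚ.+ b ℚ.* lucas/fib (u n)) k
      ≡⟨ sumFrom1-+ (λ _ → a) (λ n → b ℚ.* lucas/fib (u n)) k ⟩
  sumFrom1 (λ _ → a) k ℚ.+ sumFrom1 (λ n → b ℚ.* lucas/fib (u n)) k
      ≡⟨ cong₂ ℚ._+_ (sumFrom1-const a k) (sumFrom1-*ˡ b (λ n → lucas/fib (u n)) k) ⟩
  fromℤ (+ k) ℚ.* a ℚ.+ b ℚ.* sumFrom1 (λ j → lucas/fib (u j)) k ∎
  where
  open ≡-Reasoning
  a = ½ ℚ.* fromℤ (lucas t)
  b = ½ ℚ.* fromℤ (F t)

tail-bracket : ∀ (v : ℕ → ℕ) k p → 1 ≤ p → (∀ j → suc (p + p) ≤ v j) →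
  fromℤ (+ k) ℚ.* lucas/fib (suc (p + p)) ℚ.≤ sumFrom1 (λ j → lucas/fib (v j)) k
  × sumFrom1 (λ j → lucas/fib (v j)) k ℚ.≤ fromℤ (+ k) ℚ.* lucas/fib (p + p)
tail-bracket v k p 1≤p large =
    subst (ℚ._≤ sumFrom1 (λ j → lucas/fib (v j)) k) (sumFrom1-const (lucas/fib (suc (p + p))) k)
      (sumFrom1-mono-≤ k (λ j _ → proj₁ (lucas/fib-between p 1≤p (large j))))
  , subst (sumFrom1 (λ j → lucas/fib (v j)) k ℚ.≤_) (sumFrom1-const (lucas/fib (p + p)) k)
      (sumFrom1-mono-≤ k (λ j _ → proj₂ (lucas/fib-between p 1≤p (large j))))

limit-closedForm : ∀ t K R → F t ≢ + 0 →
  fromℚ (divℤ (+ 1) (F t)) ⊗ (fromℚ (K ℚ.* (½ ℚ.* fromℤ (lucas t)) ℚ.+ ½ ℚ.* fromℤ (F t) ℚ.* R)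
                              ⊖ fromℚ K ⊗ lucas+fib√5/2 t)
  ≡ (½ ℚ.* R) +√5· (ℚ.- (½ ℚ.* K))
limit-closedForm t K R Ft≢0 = cong₂ _+√5·_
  (trans (re-part w f (fromℤ (lucas t)) K R) (trans (cong (½ ℚ.* R ℚ.*_) w*f≡1) (ℚP.*-identityʳ (½ ℚ.* R))))
  (trans (im-part w f (fromℤ (lucas t)) K R) (trans (cong (ℚ.- (½ ℚ.* K) ℚ.*_) w*f≡1) (ℚP.*-identityʳ (ℚ.- (½ ℚ.* K)))))
  where
  w = divℤ (+ 1) (F t)
  f = fromℤ (F t)
  w*f≡1 : w ℚ.* f ≡ 1ℚ
  w*f≡1 = divℤ-*ʳ (+ 1) Ft≢0
  -- The two components of the left-hand side, as ⊗, ⊖ and fromℚ unfold.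
  re-part : ∀ w f l K R →
    w ℚ.* (K ℚ.* (½ ℚ.* l) ℚ.+ ½ ℚ.* f ℚ.* R ℚ.+ ℚ.- (K ℚ.* (½ ℚ.* l) ℚ.+ fromℤ (+ 5) ℚ.* 0ℚ ℚ.* (½ ℚ.* f)))
    ℚ.+ fromℤ (+ 5) ℚ.* 0ℚ ℚ.* (0ℚ ℚ.+ ℚ.- (K ℚ.* (½ ℚ.* f) ℚ.+ 0ℚ ℚ.* (½ ℚ.* l)))
    ≡ ½ ℚ.* R ℚ.* (w ℚ.* f)
  re-part = solve-∀ ℚ-ring
  im-part : ∀ w f l K R →
    w ℚ.* (0ℚ ℚ.+ ℚ.- (K ℚ.* (½ ℚ.* f) ℚ.+ 0ℚ ℚ.* (½ ℚ.* l)))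
    ℚ.+ 0ℚ ℚ.* (K ℚ.* (½ ℚ.* l) ℚ.+ ½ ℚ.* f ℚ.* R ℚ.+ ℚ.- (K ℚ.* (½ ℚ.* l) ℚ.+ fromℤ (+ 5) ℚ.* 0ℚ ℚ.* (½ ℚ.* f)))
    ≡ ℚ.- (½ ℚ.* K) ℚ.* (w ℚ.* f)
  im-part = solve-∀ ℚ-ring

telescoped-Close : ∀ {S L R q K lo hi ε} → S ≡ ½ ℚ.* (R ℚ.- q) → L ≡ (½ ℚ.* R) +√5· (ℚ.- (½ ℚ.* K)) →
  0ℚ ℚ.≤ K → lo ≤√5 → √5≤ hi → K ℚ.* lo ℚ.≤ q → q ℚ.≤ K ℚ.* hi → ½ ℚ.* K ℚ.* (hi ℚ.- lo) ℚ.< ε →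
  Close (fromℚ S) L ε
telescoped-Close {R = R} {q} {K} {lo} {hi} {ε} refl refl 0≤K lo≤√5 √5≤hi Klo≤q q≤Khi gap =
  Close-resp ε (fromℚ (½ ℚ.* (R ℚ.- q))) ((½ ℚ.* R) +√5· (ℚ.- (½ ℚ.* K))) (0ℚ +√5· (½ ℚ.* K)) (fromℚ (½ ℚ.* q))
    (re-diff R q) (im-diff K)
    (√5-bracket⇒Close (ℚP.*-monoˡ-≤-nonNeg ½ 0≤K) lo≤√5 √5≤hi
      (subst (ℚ._≤ ½ ℚ.* q) (sym (ℚP.*-assoc ½ K lo)) (ℚP.*-monoˡ-≤-nonNeg ½ Klo≤q))
      (subst (½ ℚ.* q ℚ.≤_) (sym (ℚP.*-assoc ½ K hi)) (ℚP.*-monoˡ-≤-nonNeg ½ q≤Khi))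
      gap)
  where
  re-diff : ∀ R q → ½ ℚ.* (R ℚ.- q) ℚ.+ ℚ.- (½ ℚ.* R) ≡ 0ℚ ℚ.+ ℚ.- (½ ℚ.* q)
  re-diff = solve-∀ ℚ-ring
  im-diff : ∀ K → 0ℚ ℚ.+ ℚ.- (ℚ.- (½ ℚ.* K)) ≡ ½ ℚ.* K ℚ.+ ℚ.- 0ℚ
  im-diff = solve-∀ ℚ-ring

theorem2p1 : (u : ℕ → ℕ) → ((n : ℕ) → 1 ≤ n → 1 ≤ u n)
    → ((M : ℕ) → Σ ℕ λ N → (n : ℕ) → N ≤ n → M ≤ u n)
    → (k : ℕ) → 1 ≤ k → (t : ℤ) → t ≢ + 0
    → SeriesConvergesTo
        (λ n → divℤ (negOnePow (u n) ℤ.* F (+ u (n + k) ℤ.- + u n))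
                    (F (+ u n) ℤ.* F (+ u (n + k))))
        (fromℚ (divℤ (+ 1) (F t))
          ⊗ (fromℚ (sumFrom1 (λ n → divℤ (F (+ u n ℤ.+ t)) (F (+ u n))) k)
             ⊖ fromℚ (divℤ (+ k) (+ 1)) ⊗ pow Φ t))
theorem2p1 u 1≤u u→∞ k _ t t≢0 ε 0<ε = N , λ m N≤m →
  let lower , upper = tail-bracket (λ j → u (m + j)) k p (s≤s z≤n)
                        (λ j → proj₂ (u→∞ (suc (p + p))) (m + j) (ℕP.≤-trans N≤m (ℕP.m≤m+n m j)))
  in telescoped-Close {R = R} (series-telescopes u k 1≤u m) limit≡ 0≤K
       (lucas/fib-odd-≤√5 {suc (p + p)} (s≤s z≤n) (cong ℤ.-_ (negOnePow-even p)))
       (lucas/fib-even-√5≤ {p + p} (ℕP.≤-trans (s≤s z≤n) (ℕP.m≤m+n p p)) (negOnePow-even p))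
       lower upper (lucas/fib-gap<ε k 0<ε)
  where
  p = suc (k ℕ.* ℚ.↧ₙ ε)
  N = proj₁ (u→∞ (suc (p + p)))
  K = fromℤ (+ k)
  R = sumFrom1 (λ j → lucas/fib (u j)) k
  0≤K : 0ℚ ℚ.≤ K
  0≤K = divℕ-mono-≤ 0 1 k 1 (s≤s z≤n) (s≤s z≤n) z≤n
  limit≡ : fromℚ (divℤ (+ 1) (F t)) ⊗ (fromℚ (sumFrom1 (λ n → divℤ (F (+ u n ℤ.+ t)) (F (+ u n))) k) ⊖ fromℚ K ⊗ pow Φ t)
           ≡ (½ ℚ.* R) +√5· (ℚ.- (½ ℚ.* K))
  limit≡ = trans (cong₂ (λ G P → fromℚ (divℤ (+ 1) (F t)) ⊗ (fromℚ G ⊖ fromℚ K ⊗ P)) (fib-shift-sum u t k 1≤u) (pow-Φ t))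
                 (limit-closedForm t K R (F≢0 t≢0))
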